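{- Let $n=p^\ell m$, where $p$ is a prime and $\ell>1$, $m\ge 2$ are integers with $\ell+p\ge 4$. If $D_n^p\neq\emptyset$, then the number of sets $T(\sigma) \in \bar{f}_{m}(K_{p^{\ell}})$ satisfying $\gcd(T(\sigma))\neq 1$ is exactly $\sum_{d\in D_n^p}(-1)^{\nu(d)-1}(m/ d)^{\frac{p^\ell-1}{2}}$.
   Context: $K_{p^\ell}=\mathrm{Cay}(\mathbb{Z}_{p^\ell},\mathbb{Z}_{p^\ell}\setminus\{0\})$. Elements of $\mathbb{Z}_N$ are identified with integers in $\{0,\dots,N-1\}$. A map $\sigma:\mathbb{Z}_{p^\ell}\to\{0,1,\dots,m-1\}$ is feasible if $\sigma(0)=0$ and $T(\sigma)=\{x+\sigma(x)p^\ell: x\in\mathbb{Z}_{p^\ell}\setminus\{0\}\}\subseteq\mathbb{Z}_{n}$ satisfies $-T(\sigma)=T(\sigma)$ in $\mathbb{Z}_n$; $\bar f_m(K_{p^\ell})$ is identified with the set of all such $T(\sigma)$ for feasible $\sigma$. $\gcd(T(\sigma))$ is the gcd of its elements as integers. $D_n^p$ is the set of square-free divisors of $n$ greater than $1$ and coprime to $p$, and $\nu(d)$ is the number of prime divisors of $d$.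
   Formalization: The prime p is odd, so that the exponent $\frac{p^\ell-1}{2}$ is a natural number. The statement above fails without it. -}

module Defs where

open import Data.Nat using (ℕ; zero; suc; _+_; _*_; _∸_; _^_; _≤_; _<_; s≤s; z≤n)
open import Data.Nat.Properties using (≤-trans; m≤m*n)
open import Data.Nat.Divisibility using (_∣_; _∣?_; ∣⇒≤)
open import Data.Nat.Coprimality using (Coprime; coprime?)
open import Data.Nat.Primality using (Prime; prime?)
open import Data.Nat.DivMod using (_/_)
open import Data.Nat.GCD using (gcd)
open import Data.Integer as ℤ using (ℤ; +_)
open import Data.Fin using (Fin; toℕ; fromℕ<)
open import Data.Fin.Properties using (any?; all?; toℕ-fromℕ<)
open import Data.Bool using (Bool)
open import Data.Bool.Properties using () renaming (_≟_ to _≟ᵇ_)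
open import Data.Vec as Vec using (Vec; []; _∷_; lookup; tabulate)
open import Data.Vec.Properties using (≡-dec)
open import Data.List as List using (List; []; _∷_; length; filter; upTo; map; concatMap; deduplicate; allFin; foldr)
open import Data.Product using (Σ; _×_; _,_; ∃)
open import Relation.Nullary using (Dec; yes; no; ¬_; does; ¬?; _×-dec_; _→-dec_)
open import Relation.Binary.PropositionalEquality using (_≡_; _≢_; subst; sym)
import Data.Nat as ℕ

SquareFree : ℕ → Set
SquareFree d = ∀ q → Prime q → ¬ (q * q ∣ d)

private
  Bounded : ℕ → Set
  Bounded d = ∀ (q : Fin (suc d)) → Prime (toℕ q) → ¬ (toℕ q * toℕ q ∣ d)

  bounded? : ∀ d → Dec (Bounded d)
  bounded? d = all? (λ q → prime? (toℕ q) →-dec ¬? (toℕ q * toℕ q ∣? d))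

  sq≤ : ∀ {q d} → q * q ∣ suc d → q < suc (suc d)
  sq≤ {zero} _ = s≤s z≤n
  sq≤ {suc q} {d} h = s≤s (≤-trans (m≤m*n (suc q) (suc q)) (∣⇒≤ h))

squareFree? : ∀ d → Dec (SquareFree (suc d))
squareFree? d with bounded? (suc d)
... | yes b = yes λ q pq h →
        let e = toℕ-fromℕ< (sq≤ {q} {d} h) in
        b (fromℕ< (sq≤ h)) (subst Prime (sym e) pq) (subst (λ r → r * r ∣ suc d) (sym e) h)
... | no ¬b = no λ sf → ¬b (λ q pq h → sf (toℕ q) pq h)

-- ν(d): the number of prime divisors of d (primes q ≤ d with q ∣ d; d ≥ 1)
ν : ℕ → ℕ
ν d = length (filter (λ q → prime? q ×-dec q ∣? d) (upTo (suc d)))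

allVecs : ∀ {A : Set} → List A → (k : ℕ) → List (Vec A k)
allVecs xs zero    = [] ∷ []
allVecs xs (suc k) = concatMap (λ a → map (a ∷_) (allVecs xs k)) xs

module Setting (p ℓ m : ℕ) where

  N : ℕ
  N = p ^ ℓ

  n : ℕ
  n = N * m

  -- a map σ : ℤ_{p^ℓ} → {0,…,m-1}, stored as its table of values
  Map : Set
  Map = Vec (Fin m) N

  σ⟨_⟩ : Map → Fin N → ℕ
  σ⟨ σ ⟩ x = toℕ (lookup σ x)

  elem : Map → Fin N → ℕ
  elem σ x = toℕ x + σ⟨ σ ⟩ x * N

  _∈T_ : Fin n → Map → Set
  y ∈T σ = ∃ λ (x : Fin N) → toℕ x ≢ 0 × toℕ y ≡ elem σ x

  _∈T?_ : ∀ y σ → Dec (y ∈T σ)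
  y ∈T? σ = any? (λ x → ¬? (toℕ x ℕ.≟ 0) ×-dec (toℕ y ℕ.≟ elem σ x))

  -- -T(σ) = T(σ) in ℤ_n.  Since negation is an involution, this is
  -- equivalent to -T ⊆ T, i.e. every y ∈ T has some z ∈ T with y + z = 0 in ℤ_n.
  Symmetric : Map → Set
  Symmetric σ = ∀ (y : Fin n) → y ∈T σ → ∃ λ (z : Fin n) → z ∈T σ × n ∣ toℕ y + toℕ z

  Feasible : Map → Set
  Feasible σ = (∀ (x : Fin N) → toℕ x ≡ 0 → σ⟨ σ ⟩ x ≡ 0) × Symmetric σ

  feasible? : ∀ σ → Dec (Feasible σ)
  feasible? σ =
    all? (λ x → (toℕ x ℕ.≟ 0) →-dec (σ⟨ σ ⟩ x ℕ.≟ 0))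
    ×-dec all? (λ y → (y ∈T? σ) →-dec any? (λ z → (z ∈T? σ) ×-dec (n ∣? (toℕ y + toℕ z))))

  gcdT : Map → ℕ
  gcdT σ = foldr gcd 0 (map (elem σ) (filter (λ x → ¬? (toℕ x ℕ.≟ 0)) (allFin N)))

  -- T(σ) as a subset of ℤ_n (characteristic vector)
  T : Map → Vec Bool n
  T σ = tabulate (λ y → does (y ∈T? σ))

  Good : Map → Set
  Good σ = Feasible σ × gcdT σ ≢ 1

  good? : ∀ σ → Dec (Good σ)
  good? σ = feasible? σ ×-dec ¬? (gcdT σ ℕ.≟ 1)

  -- the number of (distinct) sets T(σ) ∈ f̄_m(K_{p^ℓ}) with gcd(T(σ)) ≠ 1
  count : ℕ
  count = length (deduplicate (≡-dec _≟ᵇ_)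
            (map T (filter good? (allVecs (allFin m) N))))

  -- D_n^p : square-free divisors d > 1 of n coprime to p  (d = suc k, 0 ≤ k < n)
  Dindex : List ℕ
  Dindex = filter (λ k → (1 ℕ.<? suc k) ×-dec (suc k ∣? n) ×-dec squareFree? k ×-dec coprime? (suc k) p)
                  (upTo n)

  D : List ℕ
  D = map suc Dindex

  formula : ℕ → ℤ
  formula e = foldr ℤ._+_ ℤ.0ℤ
    (map (λ k → (ℤ.-1ℤ ℤ.^ (ν (suc k) ∸ 1)) ℤ.* ((+ (m / suc k)) ℤ.^ e)) Dindex)

{-# OPTIONS --safe #-}
module Submission where

-- A map σ is feasible iff σ(0) = 0 and σ(x) + σ(-x) = m - 1 for x ≠ 0, so, writing p^ℓ = 2e + 1,
-- feasible maps are determined by their values at 1, …, e, and σ ↦ T(σ) is injective on them.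
-- For feasible σ, g = gcd T(σ) divides n and is prime to p (it divides 1 + σ(1) p^ℓ), so Möbius
-- inversion gives [g ≠ 1] = Σ_{d ∈ D} (-1)^(ν(d)-1) [d ∣ g].  Moreover d ∣ g iff d ∣ x + σ(x) p^ℓ
-- for x = 1, …, e, the other half following from (x + σ(x) p^ℓ) + (-x + σ(-x) p^ℓ) = n.  Since d is
-- prime to p^ℓ and divides m, each of these e conditions holds for exactly m/d values of σ(x).

open import Defs

module Sums where

  open import Data.Nat as ℕ using (ℕ; zero; suc; z≤n; s≤s)
  import Data.Nat.Properties as ℕₚ
  open import Data.Integer using (ℤ; +_; 0ℤ; 1ℤ; _+_; _*_; -_; _-_)
  import Data.Integer.Properties as ℤₚ
  open import Data.Integer.Tactic.RingSolver using (solve-∀)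
  open import Data.List using (List; []; _∷_; _++_; map; filter; foldr; length; upTo; applyUpTo; allFin; tabulate)
  open import Data.List.Membership.Propositional using (_∈_)
  open import Data.List.Relation.Unary.Any using (here; there)
  open import Data.Fin as Fin using (Fin; toℕ)
  open import Data.Product using (_,_)
  open import Data.Empty using (⊥-elim)
  open import Data.Bool using (true; false)
  open import Relation.Nullary using (Dec; yes; no; does; _because_; ¬_; ¬?; _×-dec_; contradiction)
  open import Relation.Nullary.Decidable using (dec-true)
  open import Relation.Unary using (Pred; Decidable)
  open import Relation.Binary.PropositionalEquality
  open import Function using (_∘_; id)
  open import Level using (Level)

  private variable
    a b p : Level
    A B : Set a
    P Q : Set p

  𝟙 : Dec P → ℤ
  𝟙 (true  because _) = 1ℤ
  𝟙 (false because _) = 0ℤ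

  𝟙-yes : (P? : Dec P) → P → 𝟙 P? ≡ 1ℤ
  𝟙-yes (yes _) _  = refl
  𝟙-yes (no ¬p) p′ = ⊥-elim (¬p p′)

  𝟙-no : (P? : Dec P) → ¬ P → 𝟙 P? ≡ 0ℤ
  𝟙-no (yes p′) ¬p = ⊥-elim (¬p p′)
  𝟙-no (no _)   _  = refl

  𝟙-⇔ : (P? : Dec P) (Q? : Dec Q) → (P → Q) → (Q → P) → 𝟙 P? ≡ 𝟙 Q?
  𝟙-⇔ (yes p′) Q? to _    = sym (𝟙-yes Q? (to p′))
  𝟙-⇔ (no ¬p)  Q? _  from = sym (𝟙-no Q? (¬p ∘ from))

  𝟙-× : (P? : Dec P) (Q? : Dec Q) → 𝟙 (P? ×-dec Q?) ≡ 𝟙 P? * 𝟙 Q?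
  𝟙-× (yes _) (yes _) = refl
  𝟙-× (yes _) (no _)  = refl
  𝟙-× (no _)  (yes _) = refl
  𝟙-× (no _)  (no _)  = refl

  𝟙-split : (P? : Dec P) (x : ℤ) → x ≡ 𝟙 (¬? P?) * x + 𝟙 P? * x
  𝟙-split (yes _) x = sym (trans (cong₂ _+_ (ℤₚ.*-zeroˡ x) (ℤₚ.*-identityˡ x)) (ℤₚ.+-identityˡ x))
  𝟙-split (no _)  x = sym (trans (cong₂ _+_ (ℤₚ.*-identityˡ x) (ℤₚ.*-zeroˡ x)) (ℤₚ.+-identityʳ x))

  𝟙-¬ : (P? : Dec P) → 𝟙 P? - 1ℤ ≡ - 𝟙 (¬? P?)
  𝟙-¬ (yes _) = refl
  𝟙-¬ (no _)  = refl

  does-≡⇒ : (P? : Dec P) (Q? : Dec Q) → does P? ≡ does Q? → P → Q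
  does-≡⇒ P? (yes q)  _  _ = q
  does-≡⇒ P? (no ¬q) eq p′ = contradiction (trans (sym (dec-true P? p′)) eq) λ ()

  ∑ : List A → (A → ℤ) → ℤ
  ∑ xs f = foldr _+_ 0ℤ (map f xs)

  ∑-cong-∈ : (xs : List A) {f g : A → ℤ} → (∀ {x} → x ∈ xs → f x ≡ g x) → ∑ xs f ≡ ∑ xs g
  ∑-cong-∈ []       _  = refl
  ∑-cong-∈ (x ∷ xs) eq = cong₂ _+_ (eq (here refl)) (∑-cong-∈ xs (eq ∘ there))

  ∑-cong : (xs : List A) {f g : A → ℤ} → (∀ x → f x ≡ g x) → ∑ xs f ≡ ∑ xs g
  ∑-cong xs eq = ∑-cong-∈ xs (λ {x} _ → eq x)

  ∑-zero : (xs : List A) → ∑ xs (λ _ → 0ℤ) ≡ 0ℤ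
  ∑-zero []       = refl
  ∑-zero (_ ∷ xs) = trans (ℤₚ.+-identityˡ _) (∑-zero xs)

  ∑-+ : (xs : List A) (f g : A → ℤ) → ∑ xs (λ x → f x + g x) ≡ ∑ xs f + ∑ xs g
  ∑-+ []       f g = refl
  ∑-+ (x ∷ xs) f g = begin
    f x + g x + ∑ xs (λ x → f x + g x) ≡⟨ cong (_+_ (f x + g x)) (∑-+ xs f g) ⟩
    f x + g x + (∑ xs f + ∑ xs g)       ≡⟨ interchange (f x) (g x) (∑ xs f) (∑ xs g) ⟩
    f x + ∑ xs f + (g x + ∑ xs g)       ∎
    where
    open ≡-Reasoning
    interchange : ∀ a b c d → a + b + (c + d) ≡ a + c + (b + d)
    interchange = solve-∀

  ∑-*ˡ : (xs : List A) (c : ℤ) (f : A → ℤ) → ∑ xs (λ x → c * f x) ≡ c * ∑ xs f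
  ∑-*ˡ []       c f = sym (ℤₚ.*-zeroʳ c)
  ∑-*ˡ (x ∷ xs) c f = trans (cong (_+_ (c * f x)) (∑-*ˡ xs c f)) (sym (ℤₚ.*-distribˡ-+ c (f x) _))

  ∑-*ʳ : (xs : List A) (c : ℤ) (f : A → ℤ) → ∑ xs (λ x → f x * c) ≡ ∑ xs f * c
  ∑-*ʳ xs c f = trans (∑-cong xs (λ x → ℤₚ.*-comm (f x) c)) (trans (∑-*ˡ xs c f) (ℤₚ.*-comm c _))

  ∑-swap : (xs : List A) (ys : List B) (f : A → B → ℤ) →
           ∑ xs (λ x → ∑ ys (f x)) ≡ ∑ ys (λ y → ∑ xs (λ x → f x y))
  ∑-swap []       ys f = sym (∑-zero ys)
  ∑-swap (x ∷ xs) ys f = trans (cong (_+_ (∑ ys (f x))) (∑-swap xs ys f)) (sym (∑-+ ys (f x) _))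

  ∑-++ : (xs ys : List A) (f : A → ℤ) → ∑ (xs ++ ys) f ≡ ∑ xs f + ∑ ys f
  ∑-++ []       ys f = sym (ℤₚ.+-identityˡ _)
  ∑-++ (x ∷ xs) ys f = trans (cong (_+_ (f x)) (∑-++ xs ys f)) (sym (ℤₚ.+-assoc (f x) _ _))

  ∑-map : (g : A → B) (xs : List A) (f : B → ℤ) → ∑ (map g xs) f ≡ ∑ xs (f ∘ g)
  ∑-map g []       f = refl
  ∑-map g (x ∷ xs) f = cong (_+_ (f (g x))) (∑-map g xs f)

  module _ {P : Pred A p} (P? : Decidable P) where

    ∑-filter : (xs : List A) (f : A → ℤ) → ∑ (filter P? xs) f ≡ ∑ xs (λ x → 𝟙 (P? x) * f x)
    ∑-filter []       f = refl
    ∑-filter (x ∷ xs) f with P? x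
    ... | yes _ = cong₂ _+_ (sym (ℤₚ.*-identityˡ (f x))) (∑-filter xs f)
    ... | no  _ = trans (∑-filter xs f) (sym (trans (cong (λ z → z + ∑ xs (λ x → 𝟙 (P? x) * f x)) (ℤₚ.*-zeroˡ (f x)))
                                                   (ℤₚ.+-identityˡ _)))

    length-filter : (xs : List A) → + length (filter P? xs) ≡ ∑ xs (𝟙 ∘ P?)
    length-filter []       = refl
    length-filter (x ∷ xs) with P? x
    ... | yes _ = cong (_+_ 1ℤ) (length-filter xs)
    ... | no  _ = trans (length-filter xs) (sym (ℤₚ.+-identityˡ _))

  ∑< : ℕ → (ℕ → ℤ) → ℤ
  ∑< zero    f = 0ℤ
  ∑< (suc k) f = f 0 + ∑< k (f ∘ suc)

  ∑-applyUpTo : (g : ℕ → A) (k : ℕ) (f : A → ℤ) → ∑ (applyUpTo g k) f ≡ ∑< k (f ∘ g)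
  ∑-applyUpTo g zero    f = refl
  ∑-applyUpTo g (suc k) f = cong (_+_ (f (g 0))) (∑-applyUpTo (g ∘ suc) k f)

  ∑-upTo : (k : ℕ) (f : ℕ → ℤ) → ∑ (upTo k) f ≡ ∑< k f
  ∑-upTo = ∑-applyUpTo id

  ∑-tabulate : (k : ℕ) (g : Fin k → A) (f : A → ℤ) (h : ℕ → ℤ) → (∀ i → f (g i) ≡ h (toℕ i)) →
               ∑ (tabulate g) f ≡ ∑< k h
  ∑-tabulate zero    g f h eq = refl
  ∑-tabulate (suc k) g f h eq = cong₂ _+_ (eq Fin.zero) (∑-tabulate k (g ∘ Fin.suc) f (h ∘ suc) (eq ∘ Fin.suc))

  ∑-allFin : (k : ℕ) (f : ℕ → ℤ) → ∑ (allFin k) (f ∘ toℕ) ≡ ∑< k f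
  ∑-allFin k f = ∑-tabulate k id (f ∘ toℕ) f (λ _ → refl)

  ∑<-cong : (k : ℕ) {f g : ℕ → ℤ} → (∀ {i} → i ℕ.< k → f i ≡ g i) → ∑< k f ≡ ∑< k g
  ∑<-cong zero    eq = refl
  ∑<-cong (suc k) eq = cong₂ _+_ (eq (s≤s z≤n)) (∑<-cong k (eq ∘ s≤s))

  ∑<-+ : (k : ℕ) (f g : ℕ → ℤ) → ∑< k (λ i → f i + g i) ≡ ∑< k f + ∑< k g
  ∑<-+ zero    f g = refl
  ∑<-+ (suc k) f g = begin
    f 0 + g 0 + ∑< k (λ i → f (suc i) + g (suc i)) ≡⟨ cong (_+_ (f 0 + g 0)) (∑<-+ k (f ∘ suc) (g ∘ suc)) ⟩
    f 0 + g 0 + (∑< k (f ∘ suc) + ∑< k (g ∘ suc)) ≡⟨ interchange (f 0) (g 0) _ _ ⟩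
    f 0 + ∑< k (f ∘ suc) + (g 0 + ∑< k (g ∘ suc)) ∎
    where
    open ≡-Reasoning
    interchange : ∀ a b c d → a + b + (c + d) ≡ a + c + (b + d)
    interchange = solve-∀

  ∑<-neg : (k : ℕ) (f : ℕ → ℤ) → ∑< k (λ i → - f i) ≡ - ∑< k f
  ∑<-neg zero    f = refl
  ∑<-neg (suc k) f = trans (cong (_+_ (- f 0)) (∑<-neg k (f ∘ suc))) (sym (ℤₚ.neg-distrib-+ (f 0) _))

  ∑<-split : (j k : ℕ) (f : ℕ → ℤ) → ∑< (j ℕ.+ k) f ≡ ∑< j f + ∑< k (λ i → f (j ℕ.+ i))
  ∑<-split zero    k f = sym (ℤₚ.+-identityˡ _)
  ∑<-split (suc j) k f = trans (cong (_+_ (f 0)) (∑<-split j k (f ∘ suc))) (sym (ℤₚ.+-assoc (f 0) _ _))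

  ∑<-zero : (k : ℕ) {f : ℕ → ℤ} → (∀ {i} → i ℕ.< k → f i ≡ 0ℤ) → ∑< k f ≡ 0ℤ
  ∑<-zero zero    eq = refl
  ∑<-zero (suc k) eq = trans (cong₂ _+_ (eq (s≤s z≤n)) (∑<-zero k (eq ∘ s≤s))) (ℤₚ.+-identityˡ 0ℤ)

  ∑<-vanishing-tail : {j k : ℕ} {f : ℕ → ℤ} → j ℕ.≤ k → (∀ {i} → j ℕ.≤ i → f i ≡ 0ℤ) → ∑< k f ≡ ∑< j f
  ∑<-vanishing-tail {j} {f = f} j≤k eq with ℕₚ.m≤n⇒∃[o]m+o≡n j≤k
  ... | o , refl = begin
    ∑< (j ℕ.+ o) f                    ≡⟨ ∑<-split j o f ⟩
    ∑< j f + ∑< o (λ i → f (j ℕ.+ i)) ≡⟨ cong (_+_ (∑< j f)) (∑<-zero o (λ {i} _ → eq (ℕₚ.m≤m+n j i))) ⟩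
    ∑< j f + 0ℤ                       ≡⟨ ℤₚ.+-identityʳ _ ⟩
    ∑< j f                            ∎
    where open ≡-Reasoning

  ∑<-single : {k c : ℕ} {f : ℕ → ℤ} → c ℕ.< k → (∀ {i} → i ℕ.< k → i ≢ c → f i ≡ 0ℤ) → ∑< k f ≡ f c
  ∑<-single {suc k} {zero}  {f} _ eq =
    trans (cong (_+_ (f 0)) (∑<-zero k (λ i<k → eq (s≤s i<k) (λ ())))) (ℤₚ.+-identityʳ (f 0))
  ∑<-single {suc k} {suc c} {f} (s≤s c<k) eq = begin
    f 0 + ∑< k (f ∘ suc)
      ≡⟨ cong₂ _+_ (eq (s≤s z≤n) (λ ())) (∑<-single c<k (λ i<k i≢c → eq (s≤s i<k) (i≢c ∘ ℕₚ.suc-injective))) ⟩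
    0ℤ + f (suc c)
      ≡⟨ ℤₚ.+-identityˡ _ ⟩
    f (suc c) ∎
    where open ≡-Reasoning

  ∑<-const : (k : ℕ) (c : ℤ) → ∑< k (λ _ → c) ≡ + k * c
  ∑<-const zero    c = sym (ℤₚ.*-zeroˡ c)
  ∑<-const (suc k) c = trans (cong (_+_ c) (∑<-const k c)) (sym (ℤₚ.suc-* (+ k) c))

  ∑<-blocks : (k q : ℕ) (f : ℕ → ℤ) → ∑< (k ℕ.* q) f ≡ ∑< k (λ j → ∑< q (λ r → f (j ℕ.* q ℕ.+ r)))
  ∑<-blocks zero    q f = refl
  ∑<-blocks (suc k) q f = begin
    ∑< (q ℕ.+ k ℕ.* q) f
      ≡⟨ ∑<-split q (k ℕ.* q) f ⟩
    ∑< q f + ∑< (k ℕ.* q) (λ i → f (q ℕ.+ i))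
      ≡⟨ cong (_+_ (∑< q f)) (∑<-blocks k q (λ i → f (q ℕ.+ i))) ⟩
    ∑< q f + ∑< k (λ j → ∑< q (λ r → f (q ℕ.+ (j ℕ.* q ℕ.+ r))))
      ≡⟨ cong (_+_ (∑< q f)) (∑<-cong k (λ _ → ∑<-cong q (λ _ → cong f (sym (ℕₚ.+-assoc q _ _))))) ⟩
    ∑< q f + ∑< k (λ j → ∑< q (λ r → f (q ℕ.+ j ℕ.* q ℕ.+ r))) ∎
    where open ≡-Reasoning

module Möbius where

  open import Data.Nat as ℕ using (ℕ; zero; suc; _≤_; _<_; z≤n; s≤s; NonZero)
  import Data.Nat.Properties as ℕₚ
  open import Data.Nat.Divisibility
  open import Data.Nat.Primality using (Prime; prime?; prime[2]; prime⇒nonZero; prime⇒irreducible; ¬prime[1]; euclidsLemma)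
  open import Data.Nat.Primality.Factorisation using (factorise)
  open import Data.Nat.ListAction using (product)
  open import Data.Integer using (ℤ; +_; 0ℤ; 1ℤ; -1ℤ; _+_; _*_; -_; _^_; _-_)
  import Data.Integer.Properties as ℤₚ
  open import Data.Integer.Tactic.RingSolver using (solve-∀)
  open import Data.List using (_∷_; []; upTo)
  open import Data.List.Relation.Unary.All using (_∷_)
  open import Data.List.Membership.Propositional.Properties using (∈-filter⁺; ∈-upTo⁺; ∈-length)
  open import Data.Product using (_×_; _,_; ∃; proj₂)
  open import Data.Sum using (inj₁; inj₂)
  open import Relation.Nullary using (Dec; yes; no; ¬_; ¬?; _×-dec_; contradiction)
  open import Relation.Binary.PropositionalEquality
  open import Function using (_∘_)
  open import Algebra.Properties.CommutativeSemigroup ℕₚ.*-commutativeSemigroup using (xy∙z≈xz∙y)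

  open Sums

  primeDivisor? : ∀ d r → Dec (Prime r × r ∣ d)
  primeDivisor? d r = prime? r ×-dec r ∣? d

  ν≡∑< : ∀ d → + ν d ≡ ∑< (suc d) (𝟙 ∘ primeDivisor? d)
  ν≡∑< d = trans (length-filter (primeDivisor? d) (upTo (suc d))) (∑-upTo (suc d) (𝟙 ∘ primeDivisor? d))

  prime∣prime⇒≡ : ∀ {r q} → Prime r → Prime q → r ∣ q → r ≡ q
  prime∣prime⇒≡ pr pq r∣q with prime⇒irreducible pq r∣q
  ... | inj₁ refl = contradiction pr ¬prime[1]
  ... | inj₂ r≡q  = r≡q

  prime∣m*q⇒∣m : ∀ {r q} j → Prime r → Prime q → r ≢ q → r ∣ j ℕ.* q → r ∣ j
  prime∣m*q⇒∣m j pr pq r≢q r∣jq with euclidsLemma j _ pr r∣jq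
  ... | inj₁ r∣j = r∣j
  ... | inj₂ r∣q = contradiction (prime∣prime⇒≡ pr pq r∣q) r≢q

  primeDivisor-*-prime : ∀ {q} j → Prime q → q ∤ j → ∀ r →
    𝟙 (primeDivisor? (j ℕ.* q) r) ≡ 𝟙 (primeDivisor? j r) + 𝟙 (r ℕ.≟ q)
  primeDivisor-*-prime {q} j pq q∤j r with r ℕ.≟ q
  ... | yes refl = trans (𝟙-yes (primeDivisor? (j ℕ.* q) q) (pq , n∣m*n j))
                         (cong (_+ 1ℤ) (sym (𝟙-no (primeDivisor? j q) (q∤j ∘ proj₂))))
  ... | no r≢q = trans (𝟙-⇔ (primeDivisor? (j ℕ.* q) r) (primeDivisor? j r)
                            (λ (pr , r∣jq) → pr , prime∣m*q⇒∣m j pr pq r≢q r∣jq)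
                            (λ (pr , r∣j) → pr , ∣m⇒∣m*n q r∣j))
                       (sym (ℤₚ.+-identityʳ _))

  ν-*-prime : ∀ {q} j → Prime q → q ∤ j → ν (j ℕ.* q) ≡ suc (ν j)
  ν-*-prime {q} j pq q∤j = ℤₚ.+-injective (begin
    + ν (j ℕ.* q)
      ≡⟨ ν≡∑< (j ℕ.* q) ⟩
    ∑< (suc (j ℕ.* q)) (𝟙 ∘ primeDivisor? (j ℕ.* q))
      ≡⟨ ∑<-cong (suc (j ℕ.* q)) (λ {r} _ → primeDivisor-*-prime j pq q∤j r) ⟩
    ∑< (suc (j ℕ.* q)) (λ r → 𝟙 (primeDivisor? j r) + 𝟙 (r ℕ.≟ q))
      ≡⟨ ∑<-+ (suc (j ℕ.* q)) (𝟙 ∘ primeDivisor? j) (λ r → 𝟙 (r ℕ.≟ q)) ⟩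
    ∑< (suc (j ℕ.* q)) (𝟙 ∘ primeDivisor? j) + ∑< (suc (j ℕ.* q)) (λ r → 𝟙 (r ℕ.≟ q))
      ≡⟨ cong₂ _+_ divisors-of-j (∑<-single (s≤s q≤jq) (λ _ r≢q → 𝟙-no (_ ℕ.≟ q) r≢q)) ⟩
    ∑< (suc j) (𝟙 ∘ primeDivisor? j) + 𝟙 (q ℕ.≟ q)
      ≡⟨ cong₂ _+_ (sym (ν≡∑< j)) (𝟙-yes (q ℕ.≟ q) refl) ⟩
    + (ν j ℕ.+ 1)
      ≡⟨ cong +_ (ℕₚ.+-comm (ν j) 1) ⟩
    + suc (ν j) ∎)
    where
    open ≡-Reasoning
    instance
      j-nonZero : NonZero j
      j-nonZero = ℕ.≢-nonZero λ { refl → q∤j (q ∣0) }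
    q≤jq : q ≤ j ℕ.* q
    q≤jq = ℕₚ.m≤n*m q j
    divisors-of-j : ∑< (suc (j ℕ.* q)) (𝟙 ∘ primeDivisor? j) ≡ ∑< (suc j) (𝟙 ∘ primeDivisor? j)
    divisors-of-j = ∑<-vanishing-tail (s≤s (ℕₚ.m≤m*n j q ⦃ prime⇒nonZero pq ⦄))
                                      (λ j<r → 𝟙-no (primeDivisor? j _) (>⇒∤ j<r ∘ proj₂))

  ∃-prime-divisor : ∀ {d} → 2 ≤ d → ∃ λ q → Prime q × q ∣ d
  ∃-prime-divisor {d@(suc _)} d≥2 with factorise d
  ... | record { factors = [] ; isFactorisation = d≡1 } = contradiction (sym d≡1) (ℕₚ.<⇒≢ d≥2)
  ... | record { factors = q ∷ qs ; isFactorisation = d≡q*qs ; factorsPrime = pq ∷ _ } =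
    q , pq , divides (product qs) (trans d≡q*qs (ℕₚ.*-comm q (product qs)))

  ν≥1 : ∀ {d} → 2 ≤ d → 1 ≤ ν d
  ν≥1 {d} d≥2 with ∃-prime-divisor d≥2
  ... | q , pq , q∣d = ∈-length (∈-filter⁺ (primeDivisor? d) (∈-upTo⁺ (s≤s q≤d)) (pq , q∣d))
    where
    q≤d : q ≤ d
    q≤d = ∣⇒≤ ⦃ ℕ.>-nonZero (ℕₚ.<-trans (s≤s z≤n) d≥2) ⦄ q∣d

  isSquareFree? : ∀ d → Dec (SquareFree d)
  isSquareFree? zero    = no λ sf → sf 2 prime[2] (4 ∣0)
  isSquareFree? (suc d) = squareFree? d

  squareFree-*⁻ : ∀ j q → SquareFree (j ℕ.* q) → SquareFree j
  squareFree-*⁻ j q sf r pr rr∣j = sf r pr (∣m⇒∣m*n q rr∣j)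

  ¬squareFree-*-prime : ∀ {q} j → Prime q → q ∣ j → ¬ SquareFree (j ℕ.* q)
  ¬squareFree-*-prime {q} j pq q∣j sf = sf q pq (*-monoˡ-∣ q q∣j)

  squareFree-*-prime : ∀ {q} j → Prime q → q ∤ j → SquareFree j → SquareFree (j ℕ.* q)
  squareFree-*-prime {q} j pq q∤j sf r pr rr∣jq with r ℕ.≟ q
  ... | yes refl = q∤j (*-cancelʳ-∣ q ⦃ prime⇒nonZero pq ⦄ rr∣jq)
  ... | no r≢q with prime∣m*q⇒∣m j pr pq r≢q (∣-trans (m∣m*n r) rr∣jq)
  ...   | divides k refl = sf r pr (*-monoˡ-∣ r r∣k)
    where
    r∣kq : r ∣ k ℕ.* q
    r∣kq = *-cancelʳ-∣ r ⦃ prime⇒nonZero pr ⦄ (subst (r ℕ.* r ∣_) (xy∙z≈xz∙y k r q) rr∣jq)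
    r∣k : r ∣ k
    r∣k = prime∣m*q⇒∣m k pr pq r≢q r∣kq

  sgn : ℕ → ℤ
  sgn k = -1ℤ ^ k

  sgn-suc : ∀ k → sgn (suc k) ≡ - sgn k
  sgn-suc k = ℤₚ.-1*i≡-i (sgn k)

  sgn-pred : ∀ {k} → 1 ≤ k → sgn (k ℕ.∸ 1) ≡ - sgn k
  sgn-pred {suc k} _ = sym (trans (cong -_ (sgn-suc k)) (ℤₚ.neg-involutive (sgn k)))

  μ : ℕ → ℤ
  μ d = 𝟙 (isSquareFree? d) * sgn (ν d)

  μ-*-prime : ∀ {q} j → Prime q → q ∤ j → μ (j ℕ.* q) ≡ - μ j
  μ-*-prime {q} j pq q∤j = begin
    𝟙 (isSquareFree? (j ℕ.* q)) * sgn (ν (j ℕ.* q))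
      ≡⟨ cong₂ _*_ (𝟙-⇔ (isSquareFree? (j ℕ.* q)) (isSquareFree? j) (squareFree-*⁻ j q) (squareFree-*-prime j pq q∤j))
                   (trans (cong sgn (ν-*-prime j pq q∤j)) (sgn-suc (ν j))) ⟩
    𝟙 (isSquareFree? j) * - sgn (ν j)  ≡⟨ sym (ℤₚ.neg-distribʳ-* (𝟙 (isSquareFree? j)) (sgn (ν j))) ⟩
    - μ j                               ∎
    where open ≡-Reasoning

  μ-*-prime-square : ∀ {q} j → Prime q → q ∣ j → μ (j ℕ.* q) ≡ 0ℤ
  μ-*-prime-square {q} j pq q∣j =
    trans (cong (_* sgn (ν (j ℕ.* q))) (𝟙-no (isSquareFree? (j ℕ.* q)) (¬squareFree-*-prime j pq q∣j)))
          (ℤₚ.*-zeroˡ (sgn (ν (j ℕ.* q))))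

  *-prime-∣ : ∀ {j q G} → Prime q → q ∤ j → q ∣ G → j ∣ G → j ℕ.* q ∣ G
  *-prime-∣ {j} {q} pq q∤j q∣G (divides g refl) with euclidsLemma g j pq q∣G
  ... | inj₁ q∣g = subst (_∣ g ℕ.* j) (ℕₚ.*-comm q j) (*-monoˡ-∣ j q∣g)
  ... | inj₂ q∣j = contradiction q∣j q∤j

  ∑<-multiples : (k q : ℕ) .{{_ : NonZero q}} (f : ℕ → ℤ) →
                 ∑< (k ℕ.* q) (λ i → 𝟙 (q ∣? i) * f i) ≡ ∑< k (λ j → f (j ℕ.* q))
  ∑<-multiples k q f = trans (∑<-blocks k q _) (∑<-cong k (λ {j} _ → block j))
    where
    open ≡-Reasoning
    block : ∀ j → ∑< q (λ r → 𝟙 (q ∣? j ℕ.* q ℕ.+ r) * f (j ℕ.* q ℕ.+ r)) ≡ f (j ℕ.* q)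
    block j = begin
      ∑< q (λ r → 𝟙 (q ∣? j ℕ.* q ℕ.+ r) * f (j ℕ.* q ℕ.+ r))
        ≡⟨ ∑<-single (ℕ.>-nonZero⁻¹ q) (λ {r} r<q r≢0 → trans (cong (_* f (j ℕ.* q ℕ.+ r))
             (𝟙-no (q ∣? j ℕ.* q ℕ.+ r) (λ q∣ → >⇒∤ ⦃ ℕ.≢-nonZero r≢0 ⦄ r<q (∣m+n∣m⇒∣n q∣ (n∣m*n j)))))
             (ℤₚ.*-zeroˡ (f (j ℕ.* q ℕ.+ r)))) ⟩
      𝟙 (q ∣? j ℕ.* q ℕ.+ 0) * f (j ℕ.* q ℕ.+ 0)  ≡⟨ cong (λ i → 𝟙 (q ∣? i) * f i) (ℕₚ.+-identityʳ (j ℕ.* q)) ⟩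
      𝟙 (q ∣? j ℕ.* q) * f (j ℕ.* q)              ≡⟨ cong (_* f (j ℕ.* q)) (𝟙-yes (q ∣? j ℕ.* q) (n∣m*n j)) ⟩
      1ℤ * f (j ℕ.* q)                            ≡⟨ ℤₚ.*-identityˡ (f (j ℕ.* q)) ⟩
      f (j ℕ.* q)                                 ∎

  -- For G > 1 fix a prime q ∣ G: the terms of d and d q cancel,
  -- as μ (d q) = - μ d if q ∤ d and μ (d q) = 0 if q ∣ d.
  ∑-μ-divisors : ∀ {G B} → 1 ≤ G → G < B → ∑< B (λ d → 𝟙 (d ∣? G) * μ d) ≡ 𝟙 (G ℕ.≟ 1)
  ∑-μ-divisors {G} {B} G≥1 G<B with G ℕ.≟ 1
  ... | yes refl = ∑<-single G<B (λ {d} _ d≢1 → trans (cong (_* μ d) (𝟙-no (d ∣? 1) (d≢1 ∘ ∣1⇒≡1))) (ℤₚ.*-zeroˡ (μ d)))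
  ... | no G≢1 with ∃-prime-divisor (ℕₚ.≤∧≢⇒< G≥1 (G≢1 ∘ sym))
  ...   | q , pq , q∣G = begin
    ∑< B Φ                               ≡⟨ ∑<-vanishing-tail B≤C Φ-beyond ⟨
    ∑< C Φ                               ≡⟨ ∑<-cong C (λ {i} _ → 𝟙-split (q ∣? i) (Φ i)) ⟩
    ∑< C (λ i → g i + 𝟙 (q ∣? i) * Φ i)  ≡⟨ ∑<-+ C g (λ i → 𝟙 (q ∣? i) * Φ i) ⟩
    ∑< C g + ∑< C (λ i → 𝟙 (q ∣? i) * Φ i)
                                         ≡⟨ cong (_+_ (∑< C g)) (∑<-multiples B q Φ) ⟩
    ∑< C g + ∑< B (λ j → Φ (j ℕ.* q))    ≡⟨ cong (_+_ (∑< C g)) (∑<-cong B (λ {j} _ → Φ-*-prime j)) ⟩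
    ∑< C g + ∑< B (λ j → - g j)          ≡⟨ cong (_+_ (∑< C g)) (∑<-neg B g) ⟩
    ∑< C g - ∑< B g                      ≡⟨ cong (λ s → ∑< C g - s) (∑<-vanishing-tail B≤C g-beyond) ⟨
    ∑< C g - ∑< C g                      ≡⟨ ℤₚ.+-inverseʳ (∑< C g) ⟩
    0ℤ                                   ∎
    where
    open ≡-Reasoning
    instance
      q-nonZero : NonZero q
      q-nonZero = prime⇒nonZero pq
    Φ : ℕ → ℤ
    Φ d = 𝟙 (d ∣? G) * μ d
    g : ℕ → ℤ
    g i = 𝟙 (¬? (q ∣? i)) * Φ i
    C : ℕ
    C = B ℕ.* q
    B≤C : B ≤ C
    B≤C = ℕₚ.m≤m*n B q
    Φ-beyond : ∀ {d} → B ≤ d → Φ d ≡ 0ℤ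
    Φ-beyond {d} B≤d = trans (cong (_* μ d) (𝟙-no (d ∣? G) (>⇒∤ ⦃ ℕ.>-nonZero G≥1 ⦄ (ℕₚ.<-≤-trans G<B B≤d))))
                             (ℤₚ.*-zeroˡ (μ d))
    g-beyond : ∀ {i} → B ≤ i → g i ≡ 0ℤ
    g-beyond {i} B≤i = trans (cong (𝟙 (¬? (q ∣? i)) *_) (Φ-beyond B≤i)) (ℤₚ.*-zeroʳ (𝟙 (¬? (q ∣? i))))
    Φ-*-prime : ∀ j → Φ (j ℕ.* q) ≡ - g j
    Φ-*-prime j with q ∣? j
    ... | yes q∣j = trans (cong (𝟙 (j ℕ.* q ∣? G) *_) (μ-*-prime-square j pq q∣j))
                          (trans (ℤₚ.*-zeroʳ (𝟙 (j ℕ.* q ∣? G))) (cong -_ (sym (ℤₚ.*-zeroˡ (Φ j)))))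
    ... | no q∤j = begin
      𝟙 (j ℕ.* q ∣? G) * μ (j ℕ.* q)
        ≡⟨ cong₂ _*_ (𝟙-⇔ (j ℕ.* q ∣? G) (j ∣? G) (∣-trans (m∣m*n q)) (*-prime-∣ pq q∤j q∣G))
           (μ-*-prime j pq q∤j) ⟩
      𝟙 (j ∣? G) * - μ j
        ≡⟨ ℤₚ.neg-distribʳ-* (𝟙 (j ∣? G)) (μ j) ⟨
      - Φ j
        ≡⟨ cong -_ (ℤₚ.*-identityˡ (Φ j)) ⟨
      - (1ℤ * Φ j) ∎

  ∑-μ-nontrivial-divisors : ∀ {G B} → 1 ≤ G → G < B →
    ∑< B (λ d → 𝟙 (1 ℕ.<? d) * (𝟙 (d ∣? G) * μ d)) ≡ - 𝟙 (¬? (G ℕ.≟ 1))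
  ∑-μ-nontrivial-divisors {G} {B} G≥1 G<B = begin
    ∑< B F                                  ≡⟨ isolate (∑< B F) ⟩
    ∑< B F + 1ℤ - 1ℤ                        ≡⟨ cong (λ s → ∑< B F + s - 1ℤ) d≡1-once ⟨
    ∑< B F + ∑< B (λ d → 𝟙 (d ℕ.≟ 1)) - 1ℤ  ≡⟨ cong (_- 1ℤ) (∑<-+ B F (λ d → 𝟙 (d ℕ.≟ 1))) ⟨
    ∑< B (λ d → F d + 𝟙 (d ℕ.≟ 1)) - 1ℤ     ≡⟨ cong (_- 1ℤ) (∑<-cong B (λ {d} _ → split d)) ⟨
    ∑< B Φ - 1ℤ                             ≡⟨ cong (_- 1ℤ) (∑-μ-divisors G≥1 G<B) ⟩
    𝟙 (G ℕ.≟ 1) - 1ℤ                        ≡⟨ 𝟙-¬ (G ℕ.≟ 1) ⟩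
    - 𝟙 (¬? (G ℕ.≟ 1))                      ∎
    where
    open ≡-Reasoning
    Φ : ℕ → ℤ
    Φ d = 𝟙 (d ∣? G) * μ d
    F : ℕ → ℤ
    F d = 𝟙 (1 ℕ.<? d) * Φ d
    isolate : ∀ x → x ≡ x + 1ℤ - 1ℤ
    isolate = solve-∀
    d≡1-once : ∑< B (λ d → 𝟙 (d ℕ.≟ 1)) ≡ 1ℤ
    d≡1-once = trans (∑<-single (ℕₚ.≤-<-trans G≥1 G<B) (λ _ d≢1 → 𝟙-no (_ ℕ.≟ 1) d≢1)) (𝟙-yes (1 ℕ.≟ 1) refl)
    split : ∀ d → Φ d ≡ F d + 𝟙 (d ℕ.≟ 1)
    split zero          = trans (cong (_* μ 0) (𝟙-no (0 ∣? G) (λ 0∣G → ℕₚ.<⇒≢ G≥1 (sym (0∣⇒≡0 0∣G)))))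
                                (ℤₚ.*-zeroˡ (μ 0))
    split (suc zero)    = cong (_* μ 1) (𝟙-yes (1 ∣? G) (1∣ G))
    split (suc (suc d)) = sym (trans (ℤₚ.+-identityʳ _) (ℤₚ.*-identityˡ (Φ (suc (suc d)))))

module Arithmetic where

  open import Data.Nat as ℕ using (ℕ; zero; suc; _+_; _*_; _^_; _≤_; _<_; z≤n; NonZero)
  import Data.Nat.Properties as ℕₚ
  open import Data.Nat.Divisibility
  open import Data.Nat.DivMod using (_/_; _%_; m≡m%n+[m/n]*n; m%n<n; m/n*n≡m; [m+kn]%n≡m%n; m<n⇒m%n≡m)
  open import Data.Nat.Coprimality using (Coprime; coprime-Bézout; coprime-divisor)
  open import Data.Nat.GCD using (gcd; gcd[m,n]∣m; gcd[m,n]∣n; gcd-greatest; module Bézout)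
  import Data.Nat.Tactic.RingSolver as ℕ-Ring
  open import Data.Integer as ℤ using (ℤ; +_; 0ℤ; 1ℤ)
  import Data.Integer.Properties as ℤₚ
  open import Data.List using ([]; _∷_; foldr)
  open import Data.List.Relation.Unary.All using (All; []; _∷_)
  open import Data.Product using (_×_; _,_; ∃)
  open import Data.Sum using (inj₁; inj₂)
  open import Relation.Nullary using (¬_; contradiction)
  open import Relation.Binary.PropositionalEquality
  open import Function using (_⇔_; mk⇔; Equivalence)

  open Sums

  ∣∧<⇒≡0 : ∀ {d t} → d ∣ t → t < d → t ≡ 0
  ∣∧<⇒≡0 {t = zero}  _   _   = refl
  ∣∧<⇒≡0 {t = suc _} d∣t t<d = contradiction d∣t (>⇒∤ t<d)

  m∣n∧0<n<m+m⇒n≡m : ∀ {m n} → m ∣ n → 0 < n → n < m + m → n ≡ m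
  m∣n∧0<n<m+m⇒n≡m (divides zero          refl) ()  _
  m∣n∧0<n<m+m⇒n≡m (divides (suc zero)    refl) _   _ = ℕₚ.+-identityʳ _
  m∣n∧0<n<m+m⇒n≡m {m} (divides (suc (suc q)) refl) _ n<2m =
    contradiction n<2m (ℕₚ.≤⇒≯ (ℕₚ.+-monoʳ-≤ m (ℕₚ.m≤m+n m (q * m))))

  +-*-injective : ∀ {N a a′ s s′} → a < N → a′ < N → a + s * N ≡ a′ + s′ * N → a ≡ a′ × s ≡ s′
  +-*-injective {N} {a} {a′} {s} {s′} a<N a′<N eq =
    a≡a′ , ℕₚ.*-cancelʳ-≡ s s′ N (ℕₚ.+-cancelˡ-≡ a _ _ (trans eq (cong (λ b → b + s′ * N) (sym a≡a′))))
    where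
    instance
      N-nonZero : NonZero N
      N-nonZero = ℕ.>-nonZero (ℕₚ.≤-<-trans z≤n a<N)
    a≡a′ : a ≡ a′
    a≡a′ = begin
      a                ≡⟨ m<n⇒m%n≡m a<N ⟨
      a % N            ≡⟨ [m+kn]%n≡m%n a s N ⟨
      (a + s * N) % N  ≡⟨ cong (_% N) eq ⟩
      (a′ + s′ * N) % N ≡⟨ [m+kn]%n≡m%n a′ s′ N ⟩
      a′ % N           ≡⟨ m<n⇒m%n≡m a′<N ⟩
      a′               ∎
      where open ≡-Reasoning

  ∣foldr-gcd⇔ : ∀ {d} xs → d ∣ foldr gcd 0 xs ⇔ All (d ∣_) xs
  ∣foldr-gcd⇔ xs = mk⇔ (to xs) (from xs)
    where
    to : ∀ {d} xs → d ∣ foldr gcd 0 xs → All (d ∣_) xs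
    to []       _   = []
    to (x ∷ xs) d∣g = ∣-trans d∣g (gcd[m,n]∣m x _) ∷ to xs (∣-trans d∣g (gcd[m,n]∣n x _))
    from : ∀ {d} xs → All (d ∣_) xs → d ∣ foldr gcd 0 xs
    from []       []           = _ ∣0
    from (x ∷ xs) (d∣x ∷ d∣xs) = gcd-greatest d∣x (from xs d∣xs)

  p∣p^k : ∀ p {k} → 1 ≤ k → p ∣ p ^ k
  p∣p^k p {suc k} _ = m∣m*n (p ^ k)

  coprime-^ : ∀ {d} p k → Coprime d p → Coprime d (p ^ k)
  coprime-^ p zero    d⊥p (_ , c∣1) = ∣1⇒≡1 c∣1
  coprime-^ p (suc k) d⊥p (c∣d , c∣p*pᵏ) =
    coprime-^ p k d⊥p (c∣d , coprime-divisor (λ (b∣c , b∣p) → d⊥p (∣-trans b∣c c∣d , b∣p)) c∣p*pᵏ)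

  -- From Bézout, 1 + y N = x d gives the solution a = c y, and 1 + x d = y N gives a = c (d - 1) y.
  solution-exists : ∀ {d N} .{{_ : NonZero d}} → Coprime d N → ∀ c → ∃ λ a → d ∣ c + a * N
  solution-exists {suc d′} {N} d⊥N c with coprime-Bézout d⊥N
  ... | Bézout.+- x y 1+yN≡xd = c * y , divides (c * x) (begin
    c + c * y * N    ≡⟨ factor c y N ⟩
    c * (1 + y * N)  ≡⟨ cong (c *_) 1+yN≡xd ⟩
    c * (x * d)      ≡⟨ ℕₚ.*-assoc c x d ⟨
    c * x * d        ∎)
    where
    open ≡-Reasoning
    d : ℕ
    d = suc d′
    factor : ∀ c y N → c + c * y * N ≡ c * (1 + y * N)
    factor = ℕ-Ring.solve-∀
  ... | Bézout.-+ x y 1+xd≡yN = c * d′ * y , divides (c + c * d′ * x) (begin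
    c + c * d′ * y * N             ≡⟨ cong (_+_ c) (ℕₚ.*-assoc (c * d′) y N) ⟩
    c + c * d′ * (y * N)           ≡⟨ cong (λ z → c + c * d′ * z) 1+xd≡yN ⟨
    c + c * d′ * (1 + x * suc d′)  ≡⟨ factor c d′ x ⟩
    (c + c * d′ * x) * suc d′      ∎)
    where
    open ≡-Reasoning
    factor : ∀ c d′ x → c + c * d′ * (1 + x * suc d′) ≡ (c + c * d′ * x) * suc d′
    factor = ℕ-Ring.solve-∀

  solution-unique-≤ : ∀ {d N c r r′} → Coprime d N → r ≤ r′ → r′ < d →
                      d ∣ c + r * N → d ∣ c + r′ * N → r ≡ r′
  solution-unique-≤ {d} {N} {c} {r} d⊥N r≤r′ r′<d h h′ with ℕₚ.m≤n⇒∃[o]m+o≡n r≤r′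
  ... | t , refl = sym (trans (cong (_+_ r) t≡0) (ℕₚ.+-identityʳ r))
    where
    shift : ∀ c r t N → c + (r + t) * N ≡ (c + r * N) + N * t
    shift = ℕ-Ring.solve-∀
    t≡0 : t ≡ 0
    t≡0 = ∣∧<⇒≡0 (coprime-divisor d⊥N (∣m+n∣m⇒∣n (subst (d ∣_) (shift c r t N) h′) h))
                  (ℕₚ.≤-<-trans (ℕₚ.m≤n+m t r) r′<d)

  solution-unique : ∀ {d N c r r′} → Coprime d N → r < d → r′ < d →
                    d ∣ c + r * N → d ∣ c + r′ * N → r ≡ r′
  solution-unique {r = r} {r′} d⊥N r<d r′<d h h′ with ℕₚ.≤-total r r′
  ... | inj₁ r≤r′ = solution-unique-≤ d⊥N r≤r′ r′<d h h′
  ... | inj₂ r′≤r = sym (solution-unique-≤ d⊥N r′≤r r<d h′ h)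

  solution-shift : ∀ {d} N c j r → d ∣ c + (j * d + r) * N ⇔ d ∣ c + r * N
  solution-shift {d} N c j r = mk⇔
    (λ h → ∣m+n∣m⇒∣n (subst (d ∣_) (shift d c j r N) h) (m∣m*n (j * N)))
    (λ h → subst (d ∣_) (sym (shift d c j r N)) (∣m∣n⇒∣m+n (m∣m*n (j * N)) h))
    where
    shift : ∀ d c j r N → c + (j * d + r) * N ≡ d * (j * N) + (c + r * N)
    shift = ℕ-Ring.solve-∀

  module _ {d N : ℕ} .{{_ : NonZero d}} (d⊥N : Coprime d N) (c : ℕ) where

    ∑<-solutions-period : ∑< d (λ a → 𝟙 (d ∣? c + a * N)) ≡ 1ℤ
    ∑<-solutions-period with solution-exists d⊥N c
    ... | a , d∣c+aN = trans (∑<-single (m%n<n a d) others) (𝟙-yes (d ∣? c + a % d * N) d∣c+[a%d]N)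
      where
      d∣c+[a%d]N : d ∣ c + a % d * N
      d∣c+[a%d]N = Equivalence.to (solution-shift N c (a / d) (a % d))
        (subst (λ a → d ∣ c + a * N) (trans (m≡m%n+[m/n]*n a d) (ℕₚ.+-comm (a % d) _)) d∣c+aN)
      others : ∀ {r} → r < d → r ≢ a % d → 𝟙 (d ∣? c + r * N) ≡ 0ℤ
      others r<d r≢a%d = 𝟙-no (d ∣? _) λ d∣c+rN → r≢a%d (solution-unique d⊥N r<d (m%n<n a d) d∣c+rN d∣c+[a%d]N)

    ∑<-solutions : ∀ {M} → d ∣ M → ∑< M (λ a → 𝟙 (d ∣? c + a * N)) ≡ + (M / d)
    ∑<-solutions {M} d∣M = begin
      ∑< M f
        ≡⟨ cong (λ k → ∑< k f) (m/n*n≡m d∣M) ⟨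
      ∑< (M / d * d) f
        ≡⟨ ∑<-blocks (M / d) d f ⟩
      ∑< (M / d) (λ j → ∑< d (λ r → f (j * d + r)))
        ≡⟨ ∑<-cong (M / d) (λ {j} _ → ∑<-cong d (λ {r} _ → periodic j r)) ⟩
      ∑< (M / d) (λ _ → ∑< d f)
        ≡⟨ ∑<-cong (M / d) (λ _ → ∑<-solutions-period) ⟩
      ∑< (M / d) (λ _ → 1ℤ)
        ≡⟨ ∑<-const (M / d) 1ℤ ⟩
      + (M / d) ℤ.* 1ℤ
        ≡⟨ ℤₚ.*-identityʳ _ ⟩
      + (M / d) ∎
      where
      open ≡-Reasoning
      f : ℕ → ℤ
      f a = 𝟙 (d ∣? c + a * N)
      periodic : ∀ j r → f (j * d + r) ≡ f r
      periodic j r = 𝟙-⇔ (d ∣? _) (d ∣? _) (Equivalence.to (solution-shift N c j r)) (Equivalence.from (solution-shift N c j r))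

module Enumeration where

  open import Data.Nat using (ℕ; zero; suc)
  open import Data.Integer using (ℤ; _+_; _*_; _^_)
  open import Data.List using (List; []; _∷_; _++_; map; concatMap; filter; length; deduplicate; cartesianProductWith)
  open import Data.List.Properties using (filter-all; length-map)
  open import Data.List.Relation.Unary.All as All using (All; []; _∷_)
  open import Data.List.Relation.Unary.All.Properties using (all-filter) renaming (map⁺ to All-map⁺)
  open import Data.List.Relation.Unary.AllPairs using ([]; _∷_)
  open import Data.List.Relation.Unary.Any using (here)
  open import Data.List.Relation.Unary.Unique.Propositional using (Unique)
  import Data.List.Relation.Unary.Unique.Propositional.Properties as Unique
  open import Data.List.Membership.Propositional using (_∈_)
  open import Data.List.Membership.Propositional.Properties
    using (∈-cartesianProductWith⁺; ∈-filter⁺; ∈-filter⁻; ∈-map⁺; ∈-map⁻)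
  open import Data.List.Membership.Propositional.Properties.WithK using (unique∧set⇒bag)
  open import Data.List.Relation.Binary.BagAndSetEquality using (∼bag⇒↭)
  open import Data.List.Relation.Binary.Permutation.Propositional.Properties using (↭-length)
  open import Data.Fin as Fin using (Fin; toℕ)
  open import Data.Fin.Properties using (all?)
  open import Data.Vec using (Vec; []; _∷_; lookup)
  open import Data.Vec.Properties using (∷-injective; tabulate∘lookup; tabulate-cong)
  open import Data.Product using (_×_; _,_; proj₂)
  open import Relation.Nullary using (Dec; ¬?; _×-dec_)
  open import Relation.Unary using (Decidable)
  open import Relation.Binary using (DecidableEquality)
  open import Relation.Binary.PropositionalEquality
  open import Function using (_∘_; mk⇔)

  open Sums

  lookup-extensionality : ∀ {A : Set} {k} {u v : Vec A k} → (∀ i → lookup u i ≡ lookup v i) → u ≡ v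
  lookup-extensionality {u = u} {v} eq = trans (sym (tabulate∘lookup u)) (trans (tabulate-cong eq) (tabulate∘lookup v))

  concatMap-map≡cartesianProductWith : ∀ {A B C : Set} (f : A → B → C) xs ys →
    concatMap (λ x → map (f x) ys) xs ≡ cartesianProductWith f xs ys
  concatMap-map≡cartesianProductWith f []       ys = refl
  concatMap-map≡cartesianProductWith f (x ∷ xs) ys = cong (map (f x) ys ++_) (concatMap-map≡cartesianProductWith f xs ys)

  allVecs-suc : ∀ {A : Set} (xs : List A) k → allVecs xs (suc k) ≡ cartesianProductWith _∷_ xs (allVecs xs k)
  allVecs-suc xs k = concatMap-map≡cartesianProductWith _∷_ xs (allVecs xs k)

  ∈-allVecs : ∀ {A : Set} {xs : List A} → (∀ a → a ∈ xs) → ∀ {k} (v : Vec A k) → v ∈ allVecs xs k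
  ∈-allVecs xs-complete []      = here refl
  ∈-allVecs {xs = xs} xs-complete {suc k} (a ∷ v) =
    subst (a ∷ v ∈_) (sym (allVecs-suc xs k)) (∈-cartesianProductWith⁺ _∷_ (xs-complete a) (∈-allVecs xs-complete v))

  allVecs⁺ : ∀ {A : Set} {xs : List A} → Unique xs → ∀ k → Unique (allVecs xs k)
  allVecs⁺ xs! zero    = [] ∷ []
  allVecs⁺ {xs = xs} xs! (suc k) =
    subst Unique (sym (allVecs-suc xs k)) (Unique.cartesianProductWith⁺ _∷_ ∷-injective xs! (allVecs⁺ xs! k))

  module _ {A B : Set} {P : A → Set} {f : A → B} (f-inj : ∀ {x y} → P x → P y → f x ≡ f y → x ≡ y) where

    Unique-map⁺-on : ∀ {xs} → All P xs → Unique xs → Unique (map f xs)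
    Unique-map⁺-on []         []          = []
    Unique-map⁺-on (px ∷ pxs) (x∉ ∷ xs!) =
      All-map⁺ (All.zipWith (λ (x≢y , py) fx≡fy → x≢y (f-inj px py fx≡fy)) (x∉ , pxs)) ∷ Unique-map⁺-on pxs xs!

  deduplicate-unique : ∀ {A : Set} (_≟_ : DecidableEquality A) {xs} → Unique xs → deduplicate _≟_ xs ≡ xs
  deduplicate-unique _≟_ {[]}     []         = refl
  deduplicate-unique _≟_ {x ∷ xs} (x∉ ∷ xs!) rewrite deduplicate-unique _≟_ xs! =
    cong (x ∷_) (filter-all (¬? ∘ (x ≟_)) x∉)

  module _ {A B : Set} {P : A → Set} {Q : B → Set} (P? : Decidable P) (Q? : Decidable Q)
           {xs : List A} {ys : List B} (xs! : Unique xs) (ys! : Unique ys)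
           (xs-complete : ∀ a → a ∈ xs) (ys-complete : ∀ b → b ∈ ys)
           (f : A → B) (g : B → A) (f-pres : ∀ {a} → P a → Q (f a)) (g-pres : ∀ {b} → Q b → P (g b))
           (g∘f : ∀ {a} → P a → g (f a) ≡ a) (f∘g : ∀ {b} → Q b → f (g b) ≡ b) where

    length-filter-bijection : length (filter P? xs) ≡ length (filter Q? ys)
    length-filter-bijection = begin
      length (filter P? xs)
        ≡⟨ length-map f (filter P? xs) ⟨
      length (map f (filter P? xs))
        ≡⟨ ↭-length (∼bag⇒↭ (unique∧set⇒bag image! (Unique.filter⁺ Q? ys!) (mk⇔ to from))) ⟩
      length (filter Q? ys) ∎
      where
      open ≡-Reasoning
      f-inj : ∀ {x y} → P x → P y → f x ≡ f y → x ≡ y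
      f-inj px py fx≡fy = trans (sym (g∘f px)) (trans (cong g fx≡fy) (g∘f py))
      image! : Unique (map f (filter P? xs))
      image! = Unique-map⁺-on f-inj (all-filter P? xs) (Unique.filter⁺ P? xs!)
      to : ∀ {b} → b ∈ map f (filter P? xs) → b ∈ filter Q? ys
      to b∈ with ∈-map⁻ f b∈
      ... | a , a∈ , refl = ∈-filter⁺ Q? (ys-complete (f a)) (f-pres (proj₂ (∈-filter⁻ P? {xs = xs} a∈)))
      from : ∀ {b} → b ∈ filter Q? ys → b ∈ map f (filter P? xs)
      from {b} b∈ = subst (_∈ map f (filter P? xs)) (f∘g qb) (∈-map⁺ f (∈-filter⁺ P? (xs-complete (g b)) (g-pres qb)))
        where
        qb : Q b
        qb = proj₂ (∈-filter⁻ Q? {xs = ys} b∈)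

  ∑-cartesianProductWith : ∀ {A B C : Set} (f : A → B → C) xs ys (F : C → ℤ) →
                           ∑ (cartesianProductWith f xs ys) F ≡ ∑ xs (λ x → ∑ ys (F ∘ f x))
  ∑-cartesianProductWith f []       ys F = refl
  ∑-cartesianProductWith f (x ∷ xs) ys F = begin
    ∑ (map (f x) ys ++ cartesianProductWith f xs ys) F
      ≡⟨ ∑-++ (map (f x) ys) _ F ⟩
    ∑ (map (f x) ys) F + ∑ (cartesianProductWith f xs ys) F
      ≡⟨ cong₂ _+_ (∑-map (f x) ys F) (∑-cartesianProductWith f xs ys F) ⟩
    ∑ ys (F ∘ f x) + ∑ xs (λ x → ∑ ys (F ∘ f x)) ∎
    where open ≡-Reasoning

  Coordinatewise : ∀ {A : Set} (R : ℕ → A → Set) {k} → Vec A k → Set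
  Coordinatewise R {k} v = ∀ (i : Fin k) → R (toℕ i) (lookup v i)

  coordinatewise? : ∀ {A : Set} {R : ℕ → A → Set} → (∀ i a → Dec (R i a)) →
                    ∀ {k} (v : Vec A k) → Dec (Coordinatewise R v)
  coordinatewise? R? v = all? (λ i → R? (toℕ i) (lookup v i))

  ∑-allVecs-coordinatewise : ∀ {A : Set} (xs : List A) {R : ℕ → A → Set} (R? : ∀ i a → Dec (R i a)) (c : ℤ) →
    (∀ i → ∑ xs (𝟙 ∘ R? i) ≡ c) → ∀ k → ∑ (allVecs xs k) (𝟙 ∘ coordinatewise? R?) ≡ c ^ k
  ∑-allVecs-coordinatewise xs R? c count zero    = refl
  ∑-allVecs-coordinatewise {A} xs {R} R? c count (suc k) = begin
    ∑ (allVecs xs (suc k)) (𝟙 ∘ coordinatewise? R?)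
      ≡⟨ cong (λ l → ∑ l (𝟙 ∘ coordinatewise? R?)) (allVecs-suc xs k) ⟩
    ∑ (cartesianProductWith _∷_ xs V) (𝟙 ∘ coordinatewise? R?)
      ≡⟨ ∑-cartesianProductWith _∷_ xs V _ ⟩
    ∑ xs (λ a → ∑ V (λ v → 𝟙 (coordinatewise? R? (a ∷ v))))
      ≡⟨ ∑-cong xs (λ a → ∑-cong V (λ v → head-tail a v)) ⟩
    ∑ xs (λ a → ∑ V (λ v → 𝟙 (R? 0 a) * 𝟙 (coordinatewise? R?′ v)))
      ≡⟨ ∑-cong xs (λ a → ∑-*ˡ V (𝟙 (R? 0 a)) _) ⟩
    ∑ xs (λ a → 𝟙 (R? 0 a) * ∑ V (𝟙 ∘ coordinatewise? R?′))
      ≡⟨ ∑-*ʳ xs _ (𝟙 ∘ R? 0) ⟩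
    ∑ xs (𝟙 ∘ R? 0) * ∑ V (𝟙 ∘ coordinatewise? R?′)
      ≡⟨ cong₂ _*_ (count 0) (∑-allVecs-coordinatewise xs R?′ c (count ∘ suc) k) ⟩
    c * c ^ k ∎
    where
    open ≡-Reasoning
    V : List (Vec A k)
    V = allVecs xs k
    R?′ : ∀ i a → Dec (R (suc i) a)
    R?′ i = R? (suc i)
    head-tail : ∀ a v → 𝟙 (coordinatewise? R? (a ∷ v)) ≡ 𝟙 (R? 0 a) * 𝟙 (coordinatewise? R?′ v)
    head-tail a v = trans (𝟙-⇔ (coordinatewise? R? (a ∷ v)) (R? 0 a ×-dec coordinatewise? R?′ v)
                                (λ r → r Fin.zero , r ∘ Fin.suc)
                                (λ { (r₀ , r) Fin.zero → r₀ ; (r₀ , r) (Fin.suc i) → r i }))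
                          (𝟙-× (R? 0 a) (coordinatewise? R?′ v))

module Halves where

  open import Data.Nat as ℕ using (ℕ; zero; suc; _+_; _*_; _∸_; _≤_; _<_; s≤s; z≤n)
  import Data.Nat.Properties as ℕₚ
  open import Data.Fin using (Fin; toℕ; fromℕ<; opposite)
  open import Data.Fin.Properties using (toℕ<n; toℕ-fromℕ<; toℕ-injective; opposite-prop; opposite-involutive)
  open import Relation.Nullary using (yes; no; ¬_; contradiction)
  open import Relation.Binary.PropositionalEquality

  toℕ+suc[opposite]≡n : ∀ {n} (i : Fin n) → toℕ i + suc (toℕ (opposite i)) ≡ n
  toℕ+suc[opposite]≡n {n} i = begin
    toℕ i + suc (toℕ (opposite i))  ≡⟨ ℕₚ.+-suc (toℕ i) _ ⟩
    suc (toℕ i) + toℕ (opposite i)  ≡⟨ cong (suc (toℕ i) +_) (opposite-prop i) ⟩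
    suc (toℕ i) + (n ∸ suc (toℕ i)) ≡⟨ ℕₚ.m+[n∸m]≡n (toℕ<n i) ⟩
    n                               ∎
    where open ≡-Reasoning

  toℕ[opposite]+suc≡n : ∀ {n} (i : Fin n) → toℕ (opposite i) + suc (toℕ i) ≡ n
  toℕ[opposite]+suc≡n i =
    subst (λ j → toℕ (opposite i) + suc (toℕ j) ≡ _) (opposite-involutive i) (toℕ+suc[opposite]≡n (opposite i))

  toℕ+suc≡n⇒opposite : ∀ {n} (i : Fin n) {j} → toℕ i + suc j ≡ n → toℕ (opposite i) ≡ j
  toℕ+suc≡n⇒opposite i i+j≡n =
    ℕₚ.suc-injective (ℕₚ.+-cancelˡ-≡ (toℕ i) _ _ (trans (toℕ+suc[opposite]≡n i) (sym i+j≡n)))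

  module HalfView {N e : ℕ} (N≡ : N ≡ 1 + 2 * e) where

    private
      N≡2e+1 : N ≡ suc (e + e)
      N≡2e+1 = trans N≡ (cong (λ k → suc (e + k)) (ℕₚ.+-identityʳ e))

      small+small<N : ∀ {a b} → a ≤ e → b ≤ e → a + b < N
      small+small<N a≤e b≤e = subst (_ <_) (sym N≡2e+1) (s≤s (ℕₚ.+-mono-≤ a≤e b≤e))

      large+large>N : ∀ {a b} → e < a → e < b → N < a + b
      large+large>N e<a e<b = subst (_< _) (sym N≡2e+1)
        (ℕₚ.≤-trans (ℕₚ.≤-reflexive (sym (cong suc (ℕₚ.+-suc e e)))) (ℕₚ.+-mono-≤ e<a e<b))

      e<N : e < N
      e<N = subst (e <_) (sym N≡2e+1) (s≤s (ℕₚ.m≤m+n e e))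

    data Half (x : Fin N) : Set where
      origin : toℕ x ≡ 0 → Half x
      lower  : (i : Fin e) → toℕ x ≡ suc (toℕ i) → Half x
      upper  : (i : Fin e) → toℕ x + suc (toℕ i) ≡ N → Half x

    half : (x : Fin N) → Half x
    half x with toℕ x in x≡
    ... | zero  = origin x≡
    ... | suc j with suc j ℕ.≤? e
    ...   | yes x≤e = lower (fromℕ< x≤e) (trans x≡ (cong suc (sym (toℕ-fromℕ< x≤e))))
    ...   | no  x≰e = upper (fromℕ< ō<e) (trans (cong (λ i → toℕ x + suc i) (toℕ-fromℕ< ō<e)) (toℕ+suc[opposite]≡n x))
      where
      ō<e : toℕ (opposite x) < e
      ō<e = ℕₚ.≰⇒> λ e≤ō → ℕₚ.<-irrefl (sym (toℕ+suc[opposite]≡n x))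
              (large+large>N (subst (e <_) (sym x≡) (ℕₚ.≰⇒> x≰e)) (s≤s e≤ō))

    ι : Fin e → Fin N
    ι i = fromℕ< (ℕₚ.≤-<-trans (toℕ<n i) e<N)

    toℕ-ι : ∀ i → toℕ (ι i) ≡ suc (toℕ i)
    toℕ-ι i = toℕ-fromℕ< _

    ι≢0 : ∀ i → toℕ (ι i) ≢ 0
    ι≢0 i ι≡0 = contradiction (trans (sym (toℕ-ι i)) ι≡0) λ ()

    upper⇒ι+x≡N : ∀ {x : Fin N} {i} → toℕ x + suc (toℕ i) ≡ N → toℕ (ι i) + toℕ x ≡ N
    upper⇒ι+x≡N {x} {i} x+i≡N = trans (cong (_+ toℕ x) (toℕ-ι i)) (trans (ℕₚ.+-comm (suc (toℕ i)) (toℕ x)) x+i≡N)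

    private
      ¬lower∧upper : ∀ {x : Fin N} {i i′ : Fin e} → toℕ x ≡ suc (toℕ i) → toℕ x + suc (toℕ i′) ≢ N
      ¬lower∧upper {i = i} {i′} x≡ x+i′≡N =
        ℕₚ.<-irrefl x+i′≡N (small+small<N (subst (_≤ e) (sym x≡) (toℕ<n i)) (toℕ<n i′))

      ¬origin∧upper : ∀ {x : Fin N} {i : Fin e} → toℕ x ≡ 0 → toℕ x + suc (toℕ i) ≢ N
      ¬origin∧upper {i = i} x≡ x+i≡N =
        ℕₚ.<-irrefl x+i≡N (small+small<N (subst (_≤ e) (sym x≡) z≤n) (toℕ<n i))

    half-origin : ∀ {x : Fin N} (x≡ : toℕ x ≡ 0) → half x ≡ origin x≡
    half-origin {x} x≡ with half x
    ... | origin x≡′   = cong origin (ℕₚ.≡-irrelevant x≡′ x≡)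
    ... | lower i x≡′  = contradiction (trans (sym x≡) x≡′) (λ ())
    ... | upper i x+i≡N = contradiction x+i≡N (¬origin∧upper x≡)

    half-lower : ∀ {x : Fin N} {i : Fin e} (x≡ : toℕ x ≡ suc (toℕ i)) → half x ≡ lower i x≡
    half-lower {x} x≡ with half x
    ... | origin x≡′ = contradiction (trans (sym x≡′) x≡) (λ ())
    ... | lower i′ x≡′ with toℕ-injective (ℕₚ.suc-injective (trans (sym x≡′) x≡))
    ...   | refl = cong (lower i′) (ℕₚ.≡-irrelevant x≡′ x≡)
    half-lower {x} x≡ | upper i′ x+i′≡N = contradiction x+i′≡N (¬lower∧upper x≡)

    half-upper : ∀ {x : Fin N} {i : Fin e} (x+i≡N : toℕ x + suc (toℕ i) ≡ N) → half x ≡ upper i x+i≡N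
    half-upper {x} x+i≡N with half x
    ... | origin x≡     = contradiction x+i≡N (¬origin∧upper x≡)
    ... | lower i′ x≡   = contradiction x+i≡N (¬lower∧upper x≡)
    ... | upper i′ x+i′≡N with toℕ-injective (ℕₚ.suc-injective (ℕₚ.+-cancelˡ-≡ (toℕ x) _ _ (trans x+i′≡N (sym x+i≡N))))
    ...   | refl = cong (upper i′) (ℕₚ.≡-irrelevant x+i′≡N x+i≡N)

module FeasibleMaps where

  open import Data.Nat as ℕ using (ℕ; zero; suc; _+_; _*_; _∸_; _^_; _≤_; _<_; s≤s; z≤n; NonZero)
  import Data.Nat.Properties as ℕₚ
  open import Data.Nat.Divisibility
  open import Data.Nat.DivMod using (_/_)
  open import Data.Nat.Coprimality using (Coprime; coprime?; coprime-divisor)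
  import Data.Nat.Tactic.RingSolver as ℕ-Ring
  open import Data.Integer as ℤ using (ℤ; +_; 0ℤ; 1ℤ; -1ℤ)
  import Data.Integer.Properties as ℤₚ
  open import Data.Integer.Tactic.RingSolver using (solve-∀)
  import Data.Bool.Properties as Bool
  open import Data.Fin using (Fin; toℕ; fromℕ<; opposite)
  open import Data.Fin.Properties using (toℕ<n; toℕ-fromℕ<; toℕ-injective)
  open import Data.Vec using (Vec; lookup; tabulate)
  open import Data.Vec.Properties using (lookup∘tabulate; tabulate∘lookup; tabulate-cong; ≡-dec)
  open import Data.List using (List; map; filter; allFin; length; upTo)
  open import Data.List.Properties using (length-map)
  import Data.List.Relation.Unary.All as All
  open import Data.List.Relation.Unary.All.Properties using (all-filter) renaming (map⁺ to All-map⁺; map⁻ to All-map⁻)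
  open import Data.List.Relation.Unary.Unique.Propositional using (Unique)
  import Data.List.Relation.Unary.Unique.Propositional.Properties as Unique
  open import Data.List.Membership.Propositional using (_∈_)
  open import Data.List.Membership.Propositional.Properties using (∈-filter⁺; ∈-filter⁻; ∈-allFin)
  open import Data.Product using (Σ; _×_; _,_; ∃; proj₁; proj₂)
  open import Relation.Nullary using (Dec; yes; no; does; ¬_; ¬?; _×-dec_; contradiction)
  open import Relation.Binary.PropositionalEquality
  open import Function using (_∘_; _⇔_; mk⇔; Equivalence)

  open Sums
  open Möbius
  open Arithmetic
  open Enumeration
  open Halves

  module _ (p ℓ m e : ℕ) (ℓ≥1 : 1 ≤ ℓ) (m≥1 : 1 ≤ m) (e≥1 : 1 ≤ e) (N≡ : p ^ ℓ ≡ 1 + 2 * e) where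

    open Setting p ℓ m
    open HalfView {e = e} N≡

    instance
      N-nonZero : NonZero N
      N-nonZero = subst NonZero (sym N≡) _
      m-nonZero : NonZero m
      m-nonZero = ℕ.>-nonZero m≥1
      n-nonZero : NonZero n
      n-nonZero = ℕₚ.m*n≢0 N m

    σ<m : ∀ σ x → σ⟨ σ ⟩ x < m
    σ<m σ x = toℕ<n (lookup σ x)

    elem<n : ∀ σ x → elem σ x < n
    elem<n σ x = begin-strict
      toℕ x + σ⟨ σ ⟩ x * N  <⟨ ℕₚ.+-monoˡ-< (σ⟨ σ ⟩ x * N) (toℕ<n x) ⟩
      suc (σ⟨ σ ⟩ x) * N    ≤⟨ ℕₚ.*-monoˡ-≤ N (σ<m σ x) ⟩
      m * N                 ≡⟨ ℕₚ.*-comm m N ⟩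
      n                     ∎
      where open ℕₚ.≤-Reasoning

    element : Map → Fin N → Fin n
    element σ x = fromℕ< (elem<n σ x)

    toℕ-element : ∀ σ x → toℕ (element σ x) ≡ elem σ x
    toℕ-element σ x = toℕ-fromℕ< (elem<n σ x)

    element∈T : ∀ σ {x} → toℕ x ≢ 0 → element σ x ∈T σ
    element∈T σ {x} x≢0 = x , x≢0 , toℕ-element σ x

    elem-injective : ∀ σ σ′ {x x′} → elem σ x ≡ elem σ′ x′ → x ≡ x′ × σ⟨ σ ⟩ x ≡ σ⟨ σ′ ⟩ x′
    elem-injective σ σ′ {x} {x′} eq = toℕ-injective (proj₁ x,σx≡x′,σ′x′) , proj₂ x,σx≡x′,σ′x′
      where
      x,σx≡x′,σ′x′ : toℕ x ≡ toℕ x′ × σ⟨ σ ⟩ x ≡ σ⟨ σ′ ⟩ x′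
      x,σx≡x′,σ′x′ = +-*-injective {N} {toℕ x} {toℕ x′} {σ⟨ σ ⟩ x} {σ⟨ σ′ ⟩ x′} (toℕ<n x) (toℕ<n x′) eq

    elem+elem : ∀ σ x x′ → elem σ x + elem σ x′ ≡ (toℕ x + toℕ x′) + (σ⟨ σ ⟩ x + σ⟨ σ ⟩ x′) * N
    elem+elem σ x x′ = regroup (toℕ x) (toℕ x′) (σ⟨ σ ⟩ x) (σ⟨ σ ⟩ x′) N
      where
      regroup : ∀ a a′ s s′ N → a + s * N + (a′ + s′ * N) ≡ (a + a′) + (s + s′) * N
      regroup = ℕ-Ring.solve-∀

    Centred : Map → Set
    Centred σ = ∀ (x : Fin N) → toℕ x ≡ 0 → σ⟨ σ ⟩ x ≡ 0

    Paired : Map → Set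
    Paired σ = ∀ {x x′ : Fin N} → toℕ x ≢ 0 → toℕ x + toℕ x′ ≡ N → σ⟨ σ ⟩ x + suc (σ⟨ σ ⟩ x′) ≡ m

    paired-sum : ∀ σ {x x′} → toℕ x + toℕ x′ ≡ N → σ⟨ σ ⟩ x + suc (σ⟨ σ ⟩ x′) ≡ m → elem σ x + elem σ x′ ≡ n
    paired-sum σ {x} {x′} x+x′≡N σx+σx′≡m = begin
      elem σ x + elem σ x′                               ≡⟨ elem+elem σ x x′ ⟩
      (toℕ x + toℕ x′) + (σ⟨ σ ⟩ x + σ⟨ σ ⟩ x′) * N      ≡⟨ cong (_+ (σ⟨ σ ⟩ x + σ⟨ σ ⟩ x′) * N) x+x′≡N ⟩
      suc (σ⟨ σ ⟩ x + σ⟨ σ ⟩ x′) * N                     ≡⟨ cong (_* N) (trans (sym (ℕₚ.+-suc _ _)) σx+σx′≡m) ⟩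
      m * N                                              ≡⟨ ℕₚ.*-comm m N ⟩
      n                                                  ∎
      where open ≡-Reasoning

    n∣elem+elem⇒paired : ∀ σ {x x′} → toℕ x ≢ 0 → n ∣ elem σ x + elem σ x′ →
                          toℕ x + toℕ x′ ≡ N × σ⟨ σ ⟩ x + suc (σ⟨ σ ⟩ x′) ≡ m
    n∣elem+elem⇒paired σ {x} {x′} x≢0 n∣ = x+x′≡N , trans (ℕₚ.+-suc s s′) s+s′≡m
      where
      s s′ : ℕ
      s = σ⟨ σ ⟩ x
      s′ = σ⟨ σ ⟩ x′
      n∣sum : n ∣ (toℕ x + toℕ x′) + (s + s′) * N
      n∣sum = subst (n ∣_) (elem+elem σ x x′) n∣
      x+x′≡N : toℕ x + toℕ x′ ≡ N
      x+x′≡N = m∣n∧0<n<m+m⇒n≡m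
        (∣m+n∣m⇒∣n (subst (N ∣_) (ℕₚ.+-comm _ ((s + s′) * N)) (∣-trans (m∣m*n m) n∣sum)) (n∣m*n (s + s′)))
        (ℕₚ.<-≤-trans (ℕₚ.n≢0⇒n>0 x≢0) (ℕₚ.m≤m+n (toℕ x) (toℕ x′)))
        (ℕₚ.+-mono-< (toℕ<n x) (toℕ<n x′))
      s+s′≡m : suc (s + s′) ≡ m
      s+s′≡m = m∣n∧0<n<m+m⇒n≡m
        (*-cancelˡ-∣ N (subst (n ∣_) (trans (cong (_+ (s + s′) * N) x+x′≡N) (ℕₚ.*-comm (suc (s + s′)) N)) n∣sum))
        (s≤s z≤n)
        (ℕₚ.+-mono-≤-< (σ<m σ x) (σ<m σ x′))

    partner : (x : Fin N) → toℕ x ≢ 0 → Σ (Fin N) λ x′ → toℕ x + toℕ x′ ≡ N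
    partner x x≢0 = fromℕ< N∸x<N , trans (cong (_+_ (toℕ x)) (toℕ-fromℕ< N∸x<N)) (ℕₚ.m+[n∸m]≡n (ℕₚ.<⇒≤ (toℕ<n x)))
      where
      N∸x<N : N ∸ toℕ x < N
      N∸x<N = ℕₚ.∸-monoʳ-< (ℕₚ.n≢0⇒n>0 x≢0) (ℕₚ.<⇒≤ (toℕ<n x))

    partner≢0 : ∀ {x x′ : Fin N} → toℕ x + toℕ x′ ≡ N → toℕ x′ ≢ 0
    partner≢0 {x} x+x′≡N x′≡0 =
      ℕₚ.<⇒≢ (toℕ<n x) (trans (sym (ℕₚ.+-identityʳ (toℕ x))) (trans (cong (_+_ (toℕ x)) (sym x′≡0)) x+x′≡N))

    feasible⇒paired : ∀ σ → Feasible σ → Paired σ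
    feasible⇒paired σ (_ , symmetric) {x} {x′} x≢0 x+x′≡N = from-negation (symmetric (element σ x) (element∈T σ x≢0))
      where
      from-negation : ∃ (λ z → z ∈T σ × n ∣ toℕ (element σ x) + toℕ z) → σ⟨ σ ⟩ x + suc (σ⟨ σ ⟩ x′) ≡ m
      from-negation (_ , (x″ , _ , z≡) , n∣) =
        subst (λ w → σ⟨ σ ⟩ x + suc (σ⟨ σ ⟩ w) ≡ m) x″≡x′ (proj₂ x,x″-paired)
        where
        x,x″-paired : toℕ x + toℕ x″ ≡ N × σ⟨ σ ⟩ x + suc (σ⟨ σ ⟩ x″) ≡ m
        x,x″-paired = n∣elem+elem⇒paired σ x≢0 (subst (n ∣_) (cong₂ _+_ (toℕ-element σ x) z≡) n∣)
        x″≡x′ : x″ ≡ x′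
        x″≡x′ = toℕ-injective (ℕₚ.+-cancelˡ-≡ (toℕ x) _ _ (trans (proj₁ x,x″-paired) (sym x+x′≡N)))

    centred∧paired⇒feasible : ∀ σ → Centred σ → Paired σ → Feasible σ
    centred∧paired⇒feasible σ centred paired = centred , symmetric
      where
      symmetric : Symmetric σ
      symmetric y (x , x≢0 , y≡) with partner x x≢0
      ... | x′ , x+x′≡N = element σ x′ , element∈T σ (partner≢0 x+x′≡N) , ∣-reflexive (sym (begin
        toℕ y + toℕ (element σ x′)  ≡⟨ cong₂ _+_ y≡ (toℕ-element σ x′) ⟩
        elem σ x + elem σ x′        ≡⟨ paired-sum σ x+x′≡N (paired x≢0 x+x′≡N) ⟩
        n                           ∎))
        where open ≡-Reasoning

    ∣gcdT⇔ : ∀ σ {d} → d ∣ gcdT σ ⇔ (∀ {x : Fin N} → toℕ x ≢ 0 → d ∣ elem σ x)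
    ∣gcdT⇔ σ {d} = mk⇔
      (λ d∣G {x} x≢0 → All.lookup (All-map⁻ (Equivalence.to (∣foldr-gcd⇔ _) d∣G)) (∈-filter⁺ nonzero? (∈-allFin x) x≢0))
      (λ d∣elem → Equivalence.from (∣foldr-gcd⇔ _) (All-map⁺ (All.map d∣elem (all-filter nonzero? (allFin N)))))
      where
      nonzero? : ∀ (x : Fin N) → Dec (toℕ x ≢ 0)
      nonzero? x = ¬? (toℕ x ℕ.≟ 0)

    one : Fin N
    one = ι (fromℕ< e≥1)

    toℕ-one : toℕ one ≡ 1
    toℕ-one = trans (toℕ-ι _) (cong suc (toℕ-fromℕ< e≥1))

    one≢0 : toℕ one ≢ 0
    one≢0 one≡0 = contradiction (trans (sym toℕ-one) one≡0) λ ()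

    gcdT∣elem-one : ∀ σ → gcdT σ ∣ 1 + σ⟨ σ ⟩ one * N
    gcdT∣elem-one σ = subst (λ k → gcdT σ ∣ k + σ⟨ σ ⟩ one * N) toℕ-one (Equivalence.to (∣gcdT⇔ σ) ∣-refl one≢0)

    gcdT≥1 : ∀ σ → 1 ≤ gcdT σ
    gcdT≥1 σ = ℕₚ.n≢0⇒n>0 λ G≡0 →
      contradiction (0∣⇒≡0 (subst (_∣ 1 + σ⟨ σ ⟩ one * N) G≡0 (gcdT∣elem-one σ))) λ ()

    gcdT⊥p : ∀ σ → Coprime (gcdT σ) p
    gcdT⊥p σ {c} (c∣G , c∣p) = ∣1⇒≡1 (∣m+n∣m⇒∣n c∣σ₁N+1 (∣n⇒∣m*n (σ⟨ σ ⟩ one) (∣-trans c∣p (p∣p^k p ℓ≥1))))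
      where
      c∣σ₁N+1 : c ∣ σ⟨ σ ⟩ one * N + 1
      c∣σ₁N+1 = subst (c ∣_) (ℕₚ.+-comm 1 (σ⟨ σ ⟩ one * N)) (∣-trans c∣G (gcdT∣elem-one σ))

    gcdT∣n : ∀ σ → Feasible σ → gcdT σ ∣ n
    gcdT∣n σ F = subst (gcdT σ ∣_) (paired-sum σ {one} {one′} one+one′≡N (feasible⇒paired σ F one≢0 one+one′≡N))
      (∣m∣n⇒∣m+n (gcdT∣elem {one} one≢0) (gcdT∣elem {one′} (partner≢0 one+one′≡N)))
      where
      one′ : Fin N
      one′ = proj₁ (partner one one≢0)
      one+one′≡N : toℕ one + toℕ one′ ≡ N
      one+one′≡N = proj₂ (partner one one≢0)
      gcdT∣elem : ∀ {x} → toℕ x ≢ 0 → gcdT σ ∣ elem σ x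
      gcdT∣elem = Equivalence.to (∣gcdT⇔ σ) ∣-refl

    ∈T-resp-T : ∀ σ σ′ {y} → T σ ≡ T σ′ → y ∈T σ → y ∈T σ′
    ∈T-resp-T σ σ′ {y} Tσ≡Tσ′ = does-≡⇒ (y ∈T? σ) (y ∈T? σ′) (begin
      does (y ∈T? σ)   ≡⟨ lookup∘tabulate (λ z → does (z ∈T? σ)) y ⟨
      lookup (T σ) y   ≡⟨ cong (λ v → lookup v y) Tσ≡Tσ′ ⟩
      lookup (T σ′) y  ≡⟨ lookup∘tabulate (λ z → does (z ∈T? σ′)) y ⟩
      does (y ∈T? σ′)  ∎)
      where open ≡-Reasoning

    T-injective : ∀ σ σ′ → Centred σ → Centred σ′ → T σ ≡ T σ′ → σ ≡ σ′
    T-injective σ σ′ centred centred′ Tσ≡Tσ′ = lookup-extensionality pointwise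
      where
      pointwise : ∀ x → lookup σ x ≡ lookup σ′ x
      pointwise x with toℕ x ℕ.≟ 0
      ... | yes x≡0 = toℕ-injective (trans (centred x x≡0) (sym (centred′ x x≡0)))
      ... | no  x≢0 = toℕ-injective (trans σx≡σ′x′ (cong (σ⟨ σ′ ⟩) (sym x≡x′)))
        where
        y∈Tσ′ : element σ x ∈T σ′
        y∈Tσ′ = ∈T-resp-T σ σ′ Tσ≡Tσ′ (element∈T σ x≢0)
        x′ : Fin N
        x′ = proj₁ y∈Tσ′
        elem≡ : elem σ x ≡ elem σ′ x′
        elem≡ = trans (sym (toℕ-element σ x)) (proj₂ (proj₂ y∈Tσ′))
        x≡x′ : x ≡ x′
        x≡x′ = proj₁ (elem-injective σ σ′ elem≡)
        σx≡σ′x′ : σ⟨ σ ⟩ x ≡ σ⟨ σ′ ⟩ x′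
        σx≡σ′x′ = proj₂ (elem-injective σ σ′ elem≡)

    L : List Map
    L = allVecs (allFin m) N

    L! : Unique L
    L! = allVecs⁺ (Unique.allFin⁺ m) N

    ∈L : ∀ σ → σ ∈ L
    ∈L = ∈-allVecs ∈-allFin

    count≡length-good : count ≡ length (filter good? L)
    count≡length-good = begin
      count                            ≡⟨ cong length (deduplicate-unique (≡-dec Bool._≟_) T[good]!) ⟩
      length (map T (filter good? L))  ≡⟨ length-map T (filter good? L) ⟩
      length (filter good? L)          ∎
      where
      open ≡-Reasoning
      T[good]! : Unique (map T (filter good? L))
      T[good]! = Unique-map⁺-on (λ {σ} {σ′} ((c , _) , _) ((c′ , _) , _) → T-injective σ σ′ c c′)
                                (all-filter good? L) (Unique.filter⁺ good? L!)

    restrict : Map → Vec (Fin m) e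
    restrict σ = tabulate (λ i → lookup σ (ι i))

    extendAt : Vec (Fin m) e → ∀ {x} → Half x → Fin m
    extendAt τ (origin _)  = fromℕ< m≥1
    extendAt τ (lower i _) = lookup τ i
    extendAt τ (upper i _) = opposite (lookup τ i)

    extend : Vec (Fin m) e → Map
    extend τ = tabulate (λ x → extendAt τ (half x))

    extend-origin : ∀ τ {x} → toℕ x ≡ 0 → σ⟨ extend τ ⟩ x ≡ 0
    extend-origin τ {x} x≡0 =
      trans (cong toℕ (trans (lookup∘tabulate _ x) (cong (extendAt τ) (half-origin x≡0)))) (toℕ-fromℕ< m≥1)

    extend-lower : ∀ τ {x i} → toℕ x ≡ suc (toℕ i) → lookup (extend τ) x ≡ lookup τ i
    extend-lower τ {x} x≡ = trans (lookup∘tabulate _ x) (cong (extendAt τ) (half-lower x≡))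

    extend-upper : ∀ τ {x i} → toℕ x + suc (toℕ i) ≡ N → lookup (extend τ) x ≡ opposite (lookup τ i)
    extend-upper τ {x} x+i≡N = trans (lookup∘tabulate _ x) (cong (extendAt τ) (half-upper x+i≡N))

    restrict∘extend : ∀ τ → restrict (extend τ) ≡ τ
    restrict∘extend τ = trans (tabulate-cong (λ i → extend-lower τ (toℕ-ι i))) (tabulate∘lookup τ)

    extend-paired : ∀ τ → Paired (extend τ)
    extend-paired τ {x} {x′} x≢0 x+x′≡N with half x
    ... | origin x≡0     = contradiction x≡0 x≢0
    ... | lower i x≡     = begin
      σ⟨ extend τ ⟩ x + suc (σ⟨ extend τ ⟩ x′)
        ≡⟨ cong₂ (λ a b → toℕ a + suc (toℕ b)) (extend-lower τ x≡) (extend-upper τ x′+i≡N) ⟩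
      toℕ (lookup τ i) + suc (toℕ (opposite (lookup τ i)))
        ≡⟨ toℕ+suc[opposite]≡n (lookup τ i) ⟩
      m ∎
      where
      open ≡-Reasoning
      x′+i≡N : toℕ x′ + suc (toℕ i) ≡ N
      x′+i≡N = trans (cong (_+_ (toℕ x′)) (sym x≡)) (trans (ℕₚ.+-comm (toℕ x′) (toℕ x)) x+x′≡N)
    ... | upper i x+i≡N  = begin
      σ⟨ extend τ ⟩ x + suc (σ⟨ extend τ ⟩ x′)
        ≡⟨ cong₂ (λ a b → toℕ a + suc (toℕ b)) (extend-upper τ x+i≡N) (extend-lower τ x′≡) ⟩
      toℕ (opposite (lookup τ i)) + suc (toℕ (lookup τ i))
        ≡⟨ toℕ[opposite]+suc≡n (lookup τ i) ⟩
      m ∎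
      where
      open ≡-Reasoning
      x′≡ : toℕ x′ ≡ suc (toℕ i)
      x′≡ = ℕₚ.+-cancelˡ-≡ (toℕ x) _ _ (trans x+x′≡N (sym x+i≡N))

    extend-feasible : ∀ τ → Feasible (extend τ)
    extend-feasible τ = centred∧paired⇒feasible (extend τ) (λ _ → extend-origin τ) (extend-paired τ)

    extend∘restrict : ∀ σ → Centred σ → Paired σ → extend (restrict σ) ≡ σ
    extend∘restrict σ centred paired = lookup-extensionality pointwise
      where
      pointwise : ∀ x → lookup (extend (restrict σ)) x ≡ lookup σ x
      pointwise x with half x
      ... | origin x≡0    = toℕ-injective (trans (extend-origin (restrict σ) x≡0) (sym (centred x x≡0)))
      ... | lower i x≡    = trans (extend-lower (restrict σ) x≡)
                                  (trans (lookup∘tabulate _ i) (cong (lookup σ) (toℕ-injective (trans (toℕ-ι i) (sym x≡)))))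
      ... | upper i x+i≡N = toℕ-injective (trans (cong toℕ (extend-upper (restrict σ) x+i≡N))
                              (toℕ+suc≡n⇒opposite (lookup (restrict σ) i) ι-paired))
        where
        ι-paired : toℕ (lookup (restrict σ) i) + suc (σ⟨ σ ⟩ x) ≡ m
        ι-paired = trans (cong (λ a → toℕ a + suc (σ⟨ σ ⟩ x)) (lookup∘tabulate _ i))
                         (paired (ι≢0 i) (upper⇒ι+x≡N x+i≡N))

    module _ (d : ℕ) where

      Coordinate : ℕ → Fin m → Set
      Coordinate i a = d ∣ suc i + toℕ a * N

      coordinate? : ∀ i a → Dec (Coordinate i a)
      coordinate? i a = d ∣? suc i + toℕ a * N

      restrict-coordinatewise : ∀ σ → d ∣ gcdT σ → Coordinatewise Coordinate (restrict σ)
      restrict-coordinatewise σ d∣G i = subst₂ (λ a b → d ∣ a + toℕ b * N) (toℕ-ι i) (sym (lookup∘tabulate _ i))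
        (Equivalence.to (∣gcdT⇔ σ) d∣G (ι≢0 i))

      extend-∣gcdT : ∀ τ → d ∣ n → Coordinatewise Coordinate τ → d ∣ gcdT (extend τ)
      extend-∣gcdT τ d∣n coordinatewise = Equivalence.from (∣gcdT⇔ (extend τ)) ∣elem
        where
        ∣elem-lower : ∀ {x i} → toℕ x ≡ suc (toℕ i) → d ∣ elem (extend τ) x
        ∣elem-lower {x} {i} x≡ = subst₂ (λ a b → d ∣ a + toℕ b * N) (sym x≡) (sym (extend-lower τ x≡)) (coordinatewise i)
        ∣elem : ∀ {x} → toℕ x ≢ 0 → d ∣ elem (extend τ) x
        ∣elem {x} x≢0 with half x
        ... | origin x≡0    = contradiction x≡0 x≢0
        ... | lower i x≡    = ∣elem-lower x≡
        ... | upper i x+i≡N = ∣m+n∣m⇒∣n (subst (d ∣_) (sym sum≡n) d∣n) (∣elem-lower (toℕ-ι i))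
          where
          ι+x≡N : toℕ (ι i) + toℕ x ≡ N
          ι+x≡N = upper⇒ι+x≡N x+i≡N
          sum≡n : elem (extend τ) (ι i) + elem (extend τ) x ≡ n
          sum≡n = paired-sum (extend τ) ι+x≡N (extend-paired τ (ι≢0 i) ι+x≡N)

      divisible? : ∀ σ → Dec (Feasible σ × d ∣ gcdT σ)
      divisible? σ = feasible? σ ×-dec d ∣? gcdT σ

      module _ .{{_ : NonZero d}} (d∣m : d ∣ m) (d⊥N : Coprime d N) where

        #divisible≡#coordinatewise :
          length (filter divisible? L) ≡ length (filter (coordinatewise? coordinate?) (allVecs (allFin m) e))
        #divisible≡#coordinatewise = length-filter-bijection divisible? (coordinatewise? coordinate?)
          L! (allVecs⁺ (Unique.allFin⁺ m) e) ∈L (∈-allVecs ∈-allFin) restrict extend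
          (λ {σ} (_ , d∣G) → restrict-coordinatewise σ d∣G)
          (λ {τ} coordinatewise → extend-feasible τ , extend-∣gcdT τ (∣n⇒∣m*n N d∣m) coordinatewise)
          (λ {σ} (F , _) → extend∘restrict σ (proj₁ F) (feasible⇒paired σ F))
          (λ {τ} _ → restrict∘extend τ)

        ∑-divisible : ∑ L (𝟙 ∘ divisible?) ≡ (+ (m / d)) ℤ.^ e
        ∑-divisible = begin
          ∑ L (𝟙 ∘ divisible?)
            ≡⟨ length-filter divisible? L ⟨
          + length (filter divisible? L)
            ≡⟨ cong +_ #divisible≡#coordinatewise ⟩
          + length (filter (coordinatewise? coordinate?) V)
            ≡⟨ length-filter (coordinatewise? coordinate?) V ⟩
          ∑ V (𝟙 ∘ coordinatewise? coordinate?)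
            ≡⟨ ∑-allVecs-coordinatewise (allFin m) coordinate? (+ (m / d)) count-coordinate e ⟩
          (+ (m / d)) ℤ.^ e ∎
          where
          open ≡-Reasoning
          V : List (Vec (Fin m) e)
          V = allVecs (allFin m) e
          count-coordinate : ∀ i → ∑ (allFin m) (𝟙 ∘ coordinate? i) ≡ + (m / d)
          count-coordinate i = trans (∑-allFin m (λ a → 𝟙 (d ∣? suc i + a * N))) (∑<-solutions d⊥N (suc i) d∣m)

    D? : ∀ k → Dec (1 < suc k × suc k ∣ n × SquareFree (suc k) × Coprime (suc k) p)
    D? k = (1 ℕ.<? suc k) ×-dec (suc k ∣? n) ×-dec squareFree? k ×-dec coprime? (suc k) p

    weight : ℕ → ℤ
    weight k = -1ℤ ℤ.^ (ν (suc k) ∸ 1)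

    ∑-D-divisors : ∀ {G} → 1 ≤ G → G ∣ n → Coprime G p →
                   ∑ Dindex (λ k → weight k ℤ.* 𝟙 (suc k ∣? G)) ≡ 𝟙 (¬? (G ℕ.≟ 1))
    ∑-D-divisors {G} G≥1 G∣n G⊥p = begin
      ∑ Dindex (λ k → weight k ℤ.* 𝟙 (suc k ∣? G))
        ≡⟨ ∑-filter D? (upTo n) _ ⟩
      ∑ (upTo n) (λ k → 𝟙 (D? k) ℤ.* (weight k ℤ.* 𝟙 (suc k ∣? G)))
        ≡⟨ ∑-upTo n _ ⟩
      ∑< n (λ k → 𝟙 (D? k) ℤ.* (weight k ℤ.* 𝟙 (suc k ∣? G)))
        ≡⟨ ∑<-cong n (λ {k} _ → pointwise k) ⟩
      ∑< n (λ k → ℤ.- F (suc k))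
        ≡⟨ ∑<-neg n (F ∘ suc) ⟩
      ℤ.- ∑< n (F ∘ suc)
        ≡⟨ cong ℤ.-_ (ℤₚ.+-identityˡ (∑< n (F ∘ suc))) ⟨
      ℤ.- ∑< (suc n) F
        ≡⟨ cong ℤ.-_ (∑-μ-nontrivial-divisors G≥1 (s≤s G≤n)) ⟩
      ℤ.- ℤ.- 𝟙 (¬? (G ℕ.≟ 1))
        ≡⟨ ℤₚ.neg-involutive _ ⟩
      𝟙 (¬? (G ℕ.≟ 1)) ∎
      where
      open ≡-Reasoning
      G≤n : G ≤ n
      G≤n = ∣⇒≤ G∣n
      F : ℕ → ℤ
      F d = 𝟙 (1 ℕ.<? d) ℤ.* (𝟙 (d ∣? G) ℤ.* μ d)
      sign-shift : ∀ d → 𝟙 (1 ℕ.<? d) ℤ.* sgn (ν d ∸ 1) ≡ ℤ.- (𝟙 (1 ℕ.<? d) ℤ.* sgn (ν d))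
      sign-shift d with 1 ℕ.<? d
      ... | no _  = refl
      ... | yes 1<d = trans (cong (1ℤ ℤ.*_) (sgn-pred (ν≥1 1<d))) (sym (ℤₚ.neg-distribʳ-* 1ℤ (sgn (ν d))))
      pointwise : ∀ k → 𝟙 (D? k) ℤ.* (weight k ℤ.* 𝟙 (suc k ∣? G))
                      ≡ ℤ.- (𝟙 (1 ℕ.<? suc k) ℤ.* (𝟙 (suc k ∣? G) ℤ.* μ (suc k)))
      pointwise k with suc k ∣? G
      ... | no _    = vanish (𝟙 (D? k)) (weight k) (𝟙 (1 ℕ.<? suc k)) (μ (suc k))
        where
        vanish : ∀ a b c d → a ℤ.* (b ℤ.* 0ℤ) ≡ ℤ.- (c ℤ.* (0ℤ ℤ.* d))
        vanish = solve-∀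
      ... | yes d∣G = begin
        𝟙 (D? k) ℤ.* (weight k ℤ.* 1ℤ)                   ≡⟨ cong (ℤ._* (weight k ℤ.* 1ℤ)) 𝟙D≡ ⟩
        𝟙 (1 ℕ.<? suc k) ℤ.* sf ℤ.* (weight k ℤ.* 1ℤ)    ≡⟨ regroup (𝟙 (1 ℕ.<? suc k)) sf (weight k) ⟩
        sf ℤ.* (𝟙 (1 ℕ.<? suc k) ℤ.* weight k)           ≡⟨ cong (sf ℤ.*_) (sign-shift (suc k)) ⟩
        sf ℤ.* ℤ.- (𝟙 (1 ℕ.<? suc k) ℤ.* sgn (ν (suc k)))  ≡⟨ regroup′ (𝟙 (1 ℕ.<? suc k)) sf (sgn (ν (suc k))) ⟩
        ℤ.- (𝟙 (1 ℕ.<? suc k) ℤ.* (1ℤ ℤ.* μ (suc k)))  ∎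
        where
        sf : ℤ
        sf = 𝟙 (isSquareFree? (suc k))
        𝟙D≡ : 𝟙 (D? k) ≡ 𝟙 (1 ℕ.<? suc k) ℤ.* sf
        𝟙D≡ = trans (𝟙-⇔ (D? k) (1 ℕ.<? suc k ×-dec isSquareFree? (suc k))
                         (λ (1<d , _ , squarefree , _) → 1<d , squarefree)
                         (λ (1<d , squarefree) → 1<d , ∣-trans d∣G G∣n , squarefree ,
                                                  λ (c∣d , c∣p) → G⊥p (∣-trans c∣d d∣G , c∣p)))
                    (𝟙-× (1 ℕ.<? suc k) (isSquareFree? (suc k)))
        regroup : ∀ a b c → a ℤ.* b ℤ.* (c ℤ.* 1ℤ) ≡ b ℤ.* (a ℤ.* c)
        regroup = solve-∀
        regroup′ : ∀ a b c → b ℤ.* ℤ.- (a ℤ.* c) ≡ ℤ.- (a ℤ.* (1ℤ ℤ.* (b ℤ.* c)))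
        regroup′ = solve-∀

    𝟙-good≡∑ : ∀ σ → 𝟙 (good? σ) ≡ ∑ Dindex (λ k → weight k ℤ.* 𝟙 (divisible? (suc k) σ))
    𝟙-good≡∑ σ = by-feasibility (feasible? σ)
      where
      open ≡-Reasoning
      by-feasibility : Dec (Feasible σ) → 𝟙 (good? σ) ≡ ∑ Dindex (λ k → weight k ℤ.* 𝟙 (divisible? (suc k) σ))
      by-feasibility (no ¬F) = begin
        𝟙 (good? σ)
          ≡⟨ 𝟙-no (good? σ) (¬F ∘ proj₁) ⟩
        0ℤ
          ≡⟨ ∑-zero Dindex ⟨
        ∑ Dindex (λ _ → 0ℤ)
          ≡⟨ ∑-cong Dindex vanishes ⟨
        ∑ Dindex (λ k → weight k ℤ.* 𝟙 (divisible? (suc k) σ)) ∎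
        where
        vanishes : ∀ k → weight k ℤ.* 𝟙 (divisible? (suc k) σ) ≡ 0ℤ
        vanishes k = trans (cong (weight k ℤ.*_) (𝟙-no (divisible? (suc k) σ) (¬F ∘ proj₁))) (ℤₚ.*-zeroʳ (weight k))
      by-feasibility (yes F) = begin
        𝟙 (good? σ)
          ≡⟨ 𝟙-⇔ (good? σ) (¬? (gcdT σ ℕ.≟ 1)) proj₂ (F ,_) ⟩
        𝟙 (¬? (gcdT σ ℕ.≟ 1))
          ≡⟨ ∑-D-divisors (gcdT≥1 σ) (gcdT∣n σ F) (gcdT⊥p σ) ⟨
        ∑ Dindex (λ k → weight k ℤ.* 𝟙 (suc k ∣? gcdT σ))
          ≡⟨ ∑-cong Dindex (λ k → cong (weight k ℤ.*_) (𝟙-⇔ (suc k ∣? gcdT σ) (divisible? (suc k) σ) (F ,_) proj₂)) ⟩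
        ∑ Dindex (λ k → weight k ℤ.* 𝟙 (divisible? (suc k) σ)) ∎

    ∑-divisible-D : ∀ {k} → k ∈ Dindex → ∑ L (𝟙 ∘ divisible? (suc k)) ≡ (+ (m / suc k)) ℤ.^ e
    ∑-divisible-D {k} k∈ with ∈-filter⁻ D? {xs = upTo n} k∈
    ... | _ , _ , d∣n , _ , d⊥p = ∑-divisible (suc k) (coprime-divisor d⊥N d∣n) d⊥N
      where
      d⊥N : Coprime (suc k) N
      d⊥N = coprime-^ p ℓ d⊥p

    count≡formula : + count ≡ formula e
    count≡formula = begin
      + count
        ≡⟨ cong +_ count≡length-good ⟩
      + length (filter good? L)
        ≡⟨ length-filter good? L ⟩
      ∑ L (𝟙 ∘ good?)
        ≡⟨ ∑-cong L 𝟙-good≡∑ ⟩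
      ∑ L (λ σ → ∑ Dindex (λ k → weight k ℤ.* 𝟙 (divisible? (suc k) σ)))
        ≡⟨ ∑-swap L Dindex _ ⟩
      ∑ Dindex (λ k → ∑ L (λ σ → weight k ℤ.* 𝟙 (divisible? (suc k) σ)))
        ≡⟨ ∑-cong Dindex (λ k → ∑-*ˡ L (weight k) _) ⟩
      ∑ Dindex (λ k → weight k ℤ.* ∑ L (𝟙 ∘ divisible? (suc k)))
        ≡⟨ ∑-cong-∈ Dindex (λ {k} k∈ → cong (weight k ℤ.*_) (∑-divisible-D k∈)) ⟩
      ∑ Dindex (λ k → weight k ℤ.* (+ (m / suc k)) ℤ.^ e)
        ≡⟨⟩
      formula e ∎
      where open ≡-Reasoning

open import Data.Nat using (ℕ; zero; suc; _+_; _*_; _^_; _<_; _≤_; s≤s; z≤n)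
open import Data.Nat.Properties using (<⇒≤)
open import Data.Nat.Divisibility using (_∣_; ∣1⇒≡1)
open import Data.Nat.Primality using (Prime; ¬prime[1])
open import Data.Integer using (+_)
open import Data.List using (List; [])
open import Relation.Nullary using (contradiction)
open import Relation.Binary.PropositionalEquality using (_≡_; _≢_; subst)

p^ℓ≡1+2e⇒e≥1 : ∀ {p ℓ e} → Prime p → 1 ≤ ℓ → p ^ ℓ ≡ 1 + 2 * e → 1 ≤ e
p^ℓ≡1+2e⇒e≥1 {p} {ℓ} {zero}  pp ℓ≥1 p^ℓ≡1 =
  contradiction (subst Prime (∣1⇒≡1 (subst (p ∣_) p^ℓ≡1 (Arithmetic.p∣p^k p ℓ≥1))) pp) ¬prime[1]
p^ℓ≡1+2e⇒e≥1 {e = suc _} _ _ _ = s≤s z≤n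

lemmaA2 : (p ℓ m : ℕ) → Prime p → 1 < ℓ → 2 ≤ m → 4 ≤ ℓ + p →
    (e : ℕ) → p ^ ℓ ≡ 1 + 2 * e →
    Setting.D p ℓ m ≢ [] →
    + Setting.count p ℓ m ≡ Setting.formula p ℓ m e
lemmaA2 p ℓ m pp 1<ℓ 2≤m _ e N≡ _ =
  FeasibleMaps.count≡formula p ℓ m e ℓ≥1 (<⇒≤ 2≤m) (p^ℓ≡1+2e⇒e≥1 pp ℓ≥1 N≡) N≡
  where
  ℓ≥1 : 1 ≤ ℓ
  ℓ≥1 = <⇒≤ 1<ℓ
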